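{- For every formula $\varphi$ of $\mathcal{L}_\Box$ whose only variable is $x$, the following are equivalent: (i) $\mathbf{FIX}\Vdash\varphi$; (ii) $\mathbf{S5[Con,Ground]}\vdash\varphi$.
   Context: Kripke fixed points. $\mathcal{L}_T$ is first-order arithmetic plus a unary predicate $\mathsf{True}$, with standard Gödel numbering $\ulcorner\cdot\urcorner$. Sentences are evaluated in strong Kleene logic $\mathsf{K3}$ (values \textsc{true}, \textsc{false}, \textsc{neither}; $\wedge$ true iff both true, false iff one false; $\neg$ swaps true/false; $\forall$ true iff all instances true, false iff some instance false; otherwise neither). For $S\subseteq\mathbb{N}$, $\mathbb{N}_S$ interprets arithmetic standardly and makes $\mathsf{True}(n)$ true iff $n\in S$, false iff $n$ is not a sentence code or $n=\ulcorner\varphi\urcorner$ with $\ulcorner\neg\varphi\urcorner\in S$, neither otherwise. A fixed point is a set $S$ of sentence codes with $S=\{\ulcorner\varphi\urcorner:\varphi\text{ true in }\mathbb{N}_S\}$ and no $\varphi$ with both $\ulcorner\varphi\urcorner,\ulcorner\neg\varphi\urcorner\in S$; values in $S$ are values in $\mathbb{N}_S$. $\mathbf{FIX}$ is the set of fixed points. Modal language and semantics. $\mathcal{L}_\Box$: formulas $\varphi::=T(x)\mid F(x)\mid\neg\varphi\mid(\varphi\wedge\varphi)\mid\Box\varphi$ over countably many variables; $\lozenge$ etc. abbreviations; $N(x):=\neg T(x)\wedge\neg F(x)$. A realization $\star$ assigns each variable $x$ an $\mathcal{L}_T$ sentence $x^\star$. For $w\in\mathbf{FIX}$: $w\Vdash_\star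 T(x)$ iff $x^\star$ is \textsc{true} in $w$; $w\Vdash_\star F(x)$ iff $x^\star$ is \textsc{false} in $w$; Boolean connectives classical; $w\Vdash_\star\Box\varphi$ iff $v\Vdash_\star\varphi$ for all $v\in\mathbf{FIX}$. $\mathbf{FIX}\Vdash\varphi$ means $w\Vdash_\star\varphi$ for every realization $\star$ and every $w\in\mathbf{FIX}$. Axioms. $\mathbf{S5}$: least set containing all substitution instances of propositional tautologies and instances of $\Box(A\to B)\to(\Box A\to\Box B)$, $\Box A\to A$, $\lozenge A\to\Box\lozenge A$, closed under modus ponens and necessitation. $\mathbf{S5[Con,Ground]}$ adds for each variable $y$ the axioms $\neg(T(y)\wedge F(y))$ and $(\lozenge T(y)\wedge\lozenge F(y))\to\lozenge N(y)$. -}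

module Defs where

open import Level using (Level; 0ℓ; Lift) renaming (suc to lsuc)
open import Data.Nat using (ℕ; zero; suc; _+_; _*_)
open import Data.Fin using (Fin; toℕ) renaming (zero to fzero; suc to fsuc)
open import Data.Product using (Σ; _×_; _,_; proj₁)
open import Data.Sum using (_⊎_)
open import Data.Bool using (Bool; true; false; not; _∧_)
open import Relation.Nullary using (¬_)
open import Relation.Unary using (Pred)
open import Relation.Binary.PropositionalEquality using (_≡_; _≢_)

data Term (n : ℕ) : Set where
  var   : Fin n → Term n
  `zero : Term n
  `suc  : Term n → Term n
  _`+_  : Term n → Term n → Term n
  _`*_  : Term n → Term n → Term n

data Fml (n : ℕ) : Set where
  _`≡_ : Term n → Term n → Fml n
  `True : Term n → Fml n
  `¬_  : Fml n → Fml n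
  _`∧_ : Fml n → Fml n → Fml n
  `∀_  : Fml (suc n) → Fml n

Sentence : Set
Sentence = Fml 0

tri : ℕ → ℕ
tri zero    = zero
tri (suc k) = suc k + tri k

pair : ℕ → ℕ → ℕ
pair a b = tri (a + b) + b

⌜_⌝ₜ : ∀ {n} → Term n → ℕ
⌜ var i ⌝ₜ   = pair 0 (toℕ i)
⌜ `zero ⌝ₜ   = pair 1 0
⌜ `suc t ⌝ₜ  = pair 2 ⌜ t ⌝ₜ
⌜ s `+ t ⌝ₜ  = pair 3 (pair ⌜ s ⌝ₜ ⌜ t ⌝ₜ)
⌜ s `* t ⌝ₜ  = pair 4 (pair ⌜ s ⌝ₜ ⌜ t ⌝ₜ)

⌜_⌝ : ∀ {n} → Fml n → ℕ
⌜ s `≡ t ⌝  = pair 0 (pair ⌜ s ⌝ₜ ⌜ t ⌝ₜ)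
⌜ `True t ⌝ = pair 1 ⌜ t ⌝ₜ
⌜ `¬ φ ⌝    = pair 2 ⌜ φ ⌝
⌜ φ `∧ ψ ⌝  = pair 3 (pair ⌜ φ ⌝ ⌜ ψ ⌝)
⌜ `∀ φ ⌝    = pair 4 ⌜ φ ⌝

IsSentenceCode : ℕ → Set
IsSentenceCode k = Σ Sentence λ φ → ⌜ φ ⌝ ≡ k

Env : ℕ → Set
Env n = Fin n → ℕ

ext : ∀ {n} → Env n → ℕ → Env (suc n)
ext ρ m fzero    = m
ext ρ m (fsuc i) = ρ i

⟦_⟧ₜ : ∀ {n} → Term n → Env n → ℕ
⟦ var i ⟧ₜ ρ  = ρ i
⟦ `zero ⟧ₜ ρ  = 0
⟦ `suc t ⟧ₜ ρ = suc (⟦ t ⟧ₜ ρ)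
⟦ s `+ t ⟧ₜ ρ = ⟦ s ⟧ₜ ρ + ⟦ t ⟧ₜ ρ
⟦ s `* t ⟧ₜ ρ = ⟦ s ⟧ₜ ρ * ⟦ t ⟧ₜ ρ

module _ (S : Pred ℕ 0ℓ) where
  mutual
    Tr : ∀ {n} → Env n → Fml n → Set
    Tr ρ (s `≡ t) = ⟦ s ⟧ₜ ρ ≡ ⟦ t ⟧ₜ ρ
    Tr ρ (`True t) = S (⟦ t ⟧ₜ ρ)
    Tr ρ (`¬ φ)    = Fa ρ φ
    Tr ρ (φ `∧ ψ)  = Tr ρ φ × Tr ρ ψ
    Tr ρ (`∀ φ)    = (m : ℕ) → Tr (ext ρ m) φ

    Fa : ∀ {n} → Env n → Fml n → Set
    Fa ρ (s `≡ t) = ⟦ s ⟧ₜ ρ ≢ ⟦ t ⟧ₜ ρ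
    Fa ρ (`True t) =
      ¬ IsSentenceCode (⟦ t ⟧ₜ ρ)
      ⊎ Σ Sentence (λ φ → ⌜ φ ⌝ ≡ ⟦ t ⟧ₜ ρ × S ⌜ `¬ φ ⌝)
    Fa ρ (`¬ φ)    = Tr ρ φ
    Fa ρ (φ `∧ ψ)  = Fa ρ φ ⊎ Fa ρ ψ
    Fa ρ (`∀ φ)    = Σ ℕ λ m → Fa (ext ρ m) φ

  emptyEnv : Env 0
  emptyEnv ()

  TrueIn : Sentence → Set
  TrueIn φ = Tr emptyEnv φ

  FalseIn : Sentence → Set
  FalseIn φ = Fa emptyEnv φ

record IsFixedPoint (S : Pred ℕ 0ℓ) : Set where
  field
    onlyTrueCodes : ∀ k → S k → Σ Sentence λ φ → ⌜ φ ⌝ ≡ k × TrueIn S φ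
    allTrueCodes  : ∀ (φ : Sentence) → TrueIn S φ → S ⌜ φ ⌝
    consistent    : ∀ (φ : Sentence) → ¬ (S ⌜ φ ⌝ × S ⌜ `¬ φ ⌝)

FIX : Set₁
FIX = Σ (Pred ℕ 0ℓ) IsFixedPoint

data MF : Set where
  T F : ℕ → MF
  ~_  : MF → MF
  _∧□_ : MF → MF → MF
  □_  : MF → MF

infixr 6 _∧□_
infixr 4 _⇒_

_⇒_ : MF → MF → MF
A ⇒ B = ~ (A ∧□ ~ B)

◇_ : MF → MF
◇ A = ~ □ ~ A

N : ℕ → MF
N x = ~ T x ∧□ ~ F x

OnlyVar : ℕ → MF → Set
OnlyVar x (T y)    = y ≡ x
OnlyVar x (F y)    = y ≡ x
OnlyVar x (~ A)    = OnlyVar x A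
OnlyVar x (A ∧□ B) = OnlyVar x A × OnlyVar x B
OnlyVar x (□ A)    = OnlyVar x A

Realization : Set
Realization = ℕ → Sentence

_⊩[_]_ : FIX → Realization → MF → Set₁
w ⊩[ ⋆ ] T x    = Lift _ (TrueIn (proj₁ w) (⋆ x))
w ⊩[ ⋆ ] F x    = Lift _ (FalseIn (proj₁ w) (⋆ x))
w ⊩[ ⋆ ] (~ A)  = ¬ (w ⊩[ ⋆ ] A)
w ⊩[ ⋆ ] (A ∧□ B) = (w ⊩[ ⋆ ] A) × (w ⊩[ ⋆ ] B)
w ⊩[ ⋆ ] (□ A)  = (v : FIX) → v ⊩[ ⋆ ] A

FIX⊩ : MF → Set₁
FIX⊩ A = (⋆ : Realization) (w : FIX) → w ⊩[ ⋆ ] A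

data PF : Set where
  p    : ℕ → PF
  ¬ₚ_  : PF → PF
  _∧ₚ_ : PF → PF → PF

evalP : (ℕ → Bool) → PF → Bool
evalP v (p i)    = v i
evalP v (¬ₚ a)   = not (evalP v a)
evalP v (a ∧ₚ b) = evalP v a ∧ evalP v b

Tautology : PF → Set
Tautology a = (v : ℕ → Bool) → evalP v a ≡ true

substP : (ℕ → MF) → PF → MF
substP σ (p i)    = σ i
substP σ (¬ₚ a)   = ~ substP σ a
substP σ (a ∧ₚ b) = substP σ a ∧□ substP σ b

data ⊢S5CG : MF → Set where
  taut   : ∀ (a : PF) → Tautology a → (σ : ℕ → MF) → ⊢S5CG (substP σ a)
  K      : ∀ A B → ⊢S5CG (□ (A ⇒ B) ⇒ (□ A ⇒ □ B))
  Tax    : ∀ A → ⊢S5CG (□ A ⇒ A)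
  5ax    : ∀ A → ⊢S5CG (◇ A ⇒ □ ◇ A)
  con    : ∀ y → ⊢S5CG (~ (T y ∧□ F y))
  ground : ∀ y → ⊢S5CG ((◇ T y ∧□ ◇ F y) ⇒ ◇ N y)
  mp     : ∀ {A B} → ⊢S5CG (A ⇒ B) → ⊢S5CG A → ⊢S5CG B
  nec    : ∀ {A} → ⊢S5CG A → ⊢S5CG (□ A)

{-# OPTIONS --safe #-}

-- Soundness: □ ranges over all of FIX, so the S5 axioms hold; Con holds because no sentence is
-- both true and false in a fixed point; Ground holds because the least fixed point lies below
-- every fixed point, so a sentence that is true in one fixed point and false in another is
-- neither in the least one.
--
-- Completeness: under a realization, a formula in the single variable x only sees the value c
-- of x⋆ in the current fixed point and the set V of values x⋆ takes across FIX.  Every pair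
-- (c, V) with c ∈ V and V ≠ {true, false} occurs: V is realized by 0 = 0, its negation, the
-- liar (neither in every fixed point), the truth-teller (true, false or neither, depending on
-- the fixed point), or a disjunction or conjunction of the last two; the self-referential
-- sentences come from a diagonal lemma whose substitution function is defined with Gödel's
-- β-function.  Conversely S5[Con,Ground] proves that one of the characteristic formulas
-- of these ten pairs holds, and each of them decides every formula in x.

module Submission where

open import Defs
open import Level using (0ℓ; lift; lower) renaming (suc to lsuc)
open import Axiom.ExcludedMiddle using (ExcludedMiddle)
open import Axiom.DoubleNegationElimination using (em⇒dne)
open import Data.Bool using (Bool; true; false; not; _∧_) renaming (T to So)
open import Data.Bool.Properties using (T-≡; T-∧; T?)
open import Data.Empty using (⊥; ⊥-elim)
open import Data.Fin using (toℕ)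
import Data.Fin as Fin
open import Data.Fin.Properties using (toℕ-injective)
open import Data.List using (List; []; _∷_)
open import Data.List.Relation.Unary.All using (All; []; _∷_)
open import Data.Nat using (ℕ; zero; suc; _+_; _*_; _∸_; _%_; _/_; ⌊_/2⌋; _⊔_; _≤_; _<_; z≤n; s≤s; NonZero)
open import Data.Nat.DivMod using (m≡m%n+[m/n]*n; [m+kn]%n≡m%n; m<n⇒m%n≡m; m%n<n)
open import Data.Nat.Properties
  using ( +-mono-≤; +-monoʳ-≤; +-comm; +-suc; +-cancelˡ-≡; +-cancelʳ-≡; m≤n+m; m≤m+n; m<m+n; n<1+n
        ; m+[n∸m]≡n; n≡⌊n+n/2⌋; m≤m⊔n; m≤n⊔m; ≤-refl; ≤-reflexive; ≤-trans; <⇒≤; <-cmp; <-irrefl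
        ; _<?_; _≟_; module ≤-Reasoning)
open import Data.Nat.Tactic.RingSolver using (solve-∀)
open import Data.Product using (Σ; _×_; _,_; proj₁; proj₂)
open import Data.Product.Function.NonDependent.Propositional using (_×-⇔_)
open import Data.Sum using (_⊎_; inj₁; inj₂; [_,_]′)
open import Data.Vec using (Vec; []; _∷_)
open import Function using (_∘_)
open import Function.Bundles using (_⇔_; mk⇔; Equivalence)
open import Function.Construct.Composition using (_⇔-∘_)
open import Function.Construct.Symmetry using (⇔-sym)
open import Relation.Binary using (tri<; tri≈; tri>)
open import Relation.Binary.PropositionalEquality
  using (_≡_; _≢_; refl; sym; trans; cong; cong₂; subst; subst₂; module ≡-Reasoning)
open import Relation.Nullary using (¬_; contradiction)
open import Relation.Nullary.Decidable using (Dec; yes; no; isYes; map′; toWitness; fromWitness)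
open import Relation.Unary using (Pred; _⊆_; ∅; ｛_｝)

open Equivalence using (to; from)

variable
  n : ℕ

tri-mono : ∀ {a b} → a ≤ b → tri a ≤ tri b
tri-mono {zero}  _         = z≤n
tri-mono {suc a} (s≤s a≤b) = +-mono-≤ (s≤s a≤b) (tri-mono a≤b)

pair<tri : ∀ a b → pair a b < tri (suc (a + b))
pair<tri a b = begin-strict
  tri (a + b) + b       ≤⟨ +-monoʳ-≤ (tri (a + b)) (m≤n+m b a) ⟩
  tri (a + b) + (a + b) ≡⟨ +-comm (tri (a + b)) (a + b) ⟩
  (a + b) + tri (a + b) <⟨ n<1+n _ ⟩
  tri (suc (a + b))     ∎
  where open ≤-Reasoning

pair≡⇒sum≡ : ∀ a b c d → pair a b ≡ pair c d → a + b ≡ c + d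
pair≡⇒sum≡ a b c d e with <-cmp (a + b) (c + d)
... | tri≈ _ a+b≡c+d _ = a+b≡c+d
... | tri< a+b<c+d _ _ =
  contradiction (≤-trans (pair<tri a b) (≤-trans (tri-mono a+b<c+d) (m≤m+n _ d))) (<-irrefl e)
... | tri> _ _ c+d<a+b =
  contradiction (≤-trans (pair<tri c d) (≤-trans (tri-mono c+d<a+b) (m≤m+n _ b))) (<-irrefl (sym e))

pair-injective : ∀ {a b c d} → pair a b ≡ pair c d → a ≡ c × b ≡ d
pair-injective {a} {b} {c} {d} e = a≡c , b≡d
  where
  a+b≡c+d = pair≡⇒sum≡ a b c d e
  b≡d = +-cancelˡ-≡ (tri (a + b)) b d (trans e (cong (λ s → tri s + d) (sym a+b≡c+d)))
  a≡c = +-cancelʳ-≡ b a c (trans a+b≡c+d (cong (c +_) (sym b≡d)))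

tagₜ payloadₜ : Term n → ℕ
tagₜ (var _)       = 0
tagₜ `zero         = 1
tagₜ (`suc _)      = 2
tagₜ (_ `+ _)      = 3
tagₜ (_ `* _)      = 4
payloadₜ (var i)   = toℕ i
payloadₜ `zero     = 0
payloadₜ (`suc t)  = ⌜ t ⌝ₜ
payloadₜ (s `+ t)  = pair ⌜ s ⌝ₜ ⌜ t ⌝ₜ
payloadₜ (s `* t)  = pair ⌜ s ⌝ₜ ⌜ t ⌝ₜ

⌜⌝ₜ-split : (t : Term n) → ⌜ t ⌝ₜ ≡ pair (tagₜ t) (payloadₜ t)
⌜⌝ₜ-split (var _)  = refl
⌜⌝ₜ-split `zero    = refl
⌜⌝ₜ-split (`suc _) = refl
⌜⌝ₜ-split (_ `+ _) = refl
⌜⌝ₜ-split (_ `* _) = refl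

tag payload : Fml n → ℕ
tag (_ `≡ _)      = 0
tag (`True _)     = 1
tag (`¬ _)        = 2
tag (_ `∧ _)      = 3
tag (`∀ _)        = 4
payload (s `≡ t)  = pair ⌜ s ⌝ₜ ⌜ t ⌝ₜ
payload (`True t) = ⌜ t ⌝ₜ
payload (`¬ φ)    = ⌜ φ ⌝
payload (φ `∧ ψ)  = pair ⌜ φ ⌝ ⌜ ψ ⌝
payload (`∀ φ)    = ⌜ φ ⌝

⌜⌝-split : (φ : Fml n) → ⌜ φ ⌝ ≡ pair (tag φ) (payload φ)
⌜⌝-split (_ `≡ _)  = refl
⌜⌝-split (`True _) = refl
⌜⌝-split (`¬ _)    = refl
⌜⌝-split (_ `∧ _)  = refl
⌜⌝-split (`∀ _)    = refl

split-injective : ∀ {A : Set} {code tag payload : A → ℕ} → (∀ x → code x ≡ pair (tag x) (payload x)) →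
                  ∀ x y → code x ≡ code y → tag x ≡ tag y × payload x ≡ payload y
split-injective split x y e = pair-injective (trans (sym (split x)) (trans e (split y)))

-- Clauses for different constructors are omitted: their tags differ, so Agda finds them absurd.
mutual
  ⌜⌝ₜ-injective : (s t : Term n) → ⌜ s ⌝ₜ ≡ ⌜ t ⌝ₜ → s ≡ t
  ⌜⌝ₜ-injective s t e = from-partsₜ s t (split-injective ⌜⌝ₜ-split s t e)

  private
    from-partsₜ : (s t : Term n) → tagₜ s ≡ tagₜ t × payloadₜ s ≡ payloadₜ t → s ≡ t
    from-partsₜ (var i)   (var j)   (_ , e) = cong var (toℕ-injective e)
    from-partsₜ `zero     `zero     _       = refl
    from-partsₜ (`suc s)  (`suc t)  (_ , e) = cong `suc (⌜⌝ₜ-injective s t e)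
    from-partsₜ (s `+ s′) (t `+ t′) (_ , e) = let e₁ , e₂ = pair-injective e in
      cong₂ _`+_ (⌜⌝ₜ-injective s t e₁) (⌜⌝ₜ-injective s′ t′ e₂)
    from-partsₜ (s `* s′) (t `* t′) (_ , e) = let e₁ , e₂ = pair-injective e in
      cong₂ _`*_ (⌜⌝ₜ-injective s t e₁) (⌜⌝ₜ-injective s′ t′ e₂)

mutual
  ⌜⌝-injective : (φ ψ : Fml n) → ⌜ φ ⌝ ≡ ⌜ ψ ⌝ → φ ≡ ψ
  ⌜⌝-injective φ ψ e = from-parts φ ψ (split-injective ⌜⌝-split φ ψ e)

  private
    from-parts : (φ ψ : Fml n) → tag φ ≡ tag ψ × payload φ ≡ payload ψ → φ ≡ ψ
    from-parts (s `≡ s′) (t `≡ t′) (_ , e) = let e₁ , e₂ = pair-injective e in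
      cong₂ _`≡_ (⌜⌝ₜ-injective s t e₁) (⌜⌝ₜ-injective s′ t′ e₂)
    from-parts (`True s) (`True t) (_ , e) = cong `True (⌜⌝ₜ-injective s t e)
    from-parts (`¬ φ)    (`¬ ψ)    (_ , e) = cong `¬_ (⌜⌝-injective φ ψ e)
    from-parts (φ `∧ φ′) (ψ `∧ ψ′) (_ , e) = let e₁ , e₂ = pair-injective e in
      cong₂ _`∧_ (⌜⌝-injective φ ψ e₁) (⌜⌝-injective φ′ ψ′ e₂)
    from-parts (`∀ φ)    (`∀ ψ)    (_ , e) = cong `∀_ (⌜⌝-injective φ ψ e)

¬-irreflexive : (φ : Fml n) → `¬ φ ≢ φ
¬-irreflexive (`¬ φ) e = ¬-irreflexive φ (cong unwrap e)
  where
  unwrap : Fml n → Fml n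
  unwrap (`¬ ψ) = ψ
  unwrap ψ      = ψ

-- Fa S ρ (`True t) unfolds to FalseCode S (⟦ t ⟧ₜ ρ).
FalseCode : Pred ℕ 0ℓ → Pred ℕ 0ℓ
FalseCode S k = ¬ IsSentenceCode k ⊎ Σ Sentence λ φ → ⌜ φ ⌝ ≡ k × S ⌜ `¬ φ ⌝

OnlyTrueCodes : Pred ℕ 0ℓ → Set
OnlyTrueCodes S = ∀ k → S k → Σ Sentence λ φ → ⌜ φ ⌝ ≡ k × TrueIn S φ

Consistent : Pred ℕ 0ℓ → Set
Consistent S = ∀ (φ : Sentence) → ¬ (S ⌜ φ ⌝ × S ⌜ `¬ φ ⌝)

record Sound (S : Pred ℕ 0ℓ) : Set where
  field
    onlyTrueCodes : OnlyTrueCodes S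
    consistent    : Consistent S

module _ {S : Pred ℕ 0ℓ} (onlyTrue : OnlyTrueCodes S) where

  codes : S ⊆ IsSentenceCode
  codes {k} x = let φ , e , _ = onlyTrue k x in φ , e

  member⇒true : ∀ φ → S ⌜ φ ⌝ → TrueIn S φ
  member⇒true φ x with onlyTrue ⌜ φ ⌝ x
  ... | ψ , e , t with refl ← ⌜⌝-injective ψ φ e = t

module _ {A B : Pred ℕ 0ℓ} (A⊆B : A ⊆ B) where
  mutual
    Tr-mono : (ρ : Env n) (φ : Fml n) → Tr A ρ φ → Tr B ρ φ
    Tr-mono ρ (s `≡ t) x       = x
    Tr-mono ρ (`True t) x      = A⊆B x
    Tr-mono ρ (`¬ φ) x         = Fa-mono ρ φ x
    Tr-mono ρ (φ `∧ ψ) (x , y) = Tr-mono ρ φ x , Tr-mono ρ ψ y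
    Tr-mono ρ (`∀ φ) x m       = Tr-mono (ext ρ m) φ (x m)

    Fa-mono : (ρ : Env n) (φ : Fml n) → Fa A ρ φ → Fa B ρ φ
    Fa-mono ρ (s `≡ t) x                   = x
    Fa-mono ρ (`True t) (inj₁ x)           = inj₁ x
    Fa-mono ρ (`True t) (inj₂ (ψ , e , x)) = inj₂ (ψ , e , A⊆B x)
    Fa-mono ρ (`¬ φ) x                     = Tr-mono ρ φ x
    Fa-mono ρ (φ `∧ ψ) (inj₁ x)            = inj₁ (Fa-mono ρ φ x)
    Fa-mono ρ (φ `∧ ψ) (inj₂ y)            = inj₂ (Fa-mono ρ ψ y)
    Fa-mono ρ (`∀ φ) (m , x)               = m , Fa-mono (ext ρ m) φ x

-- Kripke's transfinite iteration of the jump from X, as an inductive family.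
data Cl (X : Pred ℕ 0ℓ) : Pred ℕ 0ℓ where
  seed : X ⊆ Cl X
  jump : (φ : Sentence) → TrueIn (Cl X) φ → Cl X ⌜ φ ⌝

module _ {X P : Pred ℕ 0ℓ} (X⊆P : X ⊆ P) (closed : ∀ φ → TrueIn P φ → P ⌜ φ ⌝) where

  -- Tr-mono cannot be reused: the recursive calls on subderivations must stay visible to
  -- the termination checker.
  mutual
    Cl-least : Cl X ⊆ P
    Cl-least (seed x)   = X⊆P x
    Cl-least (jump φ t) = closed φ (Tr-least _ φ t)

    private
      Tr-least : (ρ : Env n) (φ : Fml n) → Tr (Cl X) ρ φ → Tr P ρ φ
      Tr-least ρ (s `≡ t) x       = x
      Tr-least ρ (`True t) x      = Cl-least x
      Tr-least ρ (`¬ φ) x         = Fa-least ρ φ x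
      Tr-least ρ (φ `∧ ψ) (x , y) = Tr-least ρ φ x , Tr-least ρ ψ y
      Tr-least ρ (`∀ φ) x m       = Tr-least (ext ρ m) φ (x m)

      Fa-least : (ρ : Env n) (φ : Fml n) → Fa (Cl X) ρ φ → Fa P ρ φ
      Fa-least ρ (s `≡ t) x                   = x
      Fa-least ρ (`True t) (inj₁ x)           = inj₁ x
      Fa-least ρ (`True t) (inj₂ (ψ , e , x)) = inj₂ (ψ , e , Cl-least x)
      Fa-least ρ (`¬ φ) x                     = Tr-least ρ φ x
      Fa-least ρ (φ `∧ ψ) (inj₁ x)            = inj₁ (Fa-least ρ φ x)
      Fa-least ρ (φ `∧ ψ) (inj₂ y)            = inj₂ (Fa-least ρ ψ y)
      Fa-least ρ (`∀ φ) (m , x)               = m , Fa-least (ext ρ m) φ x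

module _ {X : Pred ℕ 0ℓ} (sound : Sound X) where
  open Sound sound

  private
    C : Pred ℕ 0ℓ
    C = Cl X

    C-codes : C ⊆ IsSentenceCode
    C-codes (seed x)   = codes onlyTrueCodes x
    C-codes (jump φ _) = φ , refl

    -- A derivation in Cl X may bottom out in a seed whose truth is only known in X, so the
    -- induction runs over the pairs (X, C), (C, X), (C, C); they are kept as separate
    -- functions so that the termination checker sees the C-derivation shrink.
    mutual
      disjoint-XC : (ρ : Env n) (φ : Fml n) → Tr X ρ φ → Fa C ρ φ → ⊥
      disjoint-XC ρ (s `≡ t) x y                   = y x
      disjoint-XC ρ (`True t) x (inj₁ y)           = y (codes onlyTrueCodes x)
      disjoint-XC ρ (`True t) x (inj₂ (ψ , e , y)) = clash-XC x y ψ (sym e) refl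
      disjoint-XC ρ (`¬ φ) x y                     = disjoint-CX ρ φ y x
      disjoint-XC ρ (φ `∧ ψ) (x , _) (inj₁ y)      = disjoint-XC ρ φ x y
      disjoint-XC ρ (φ `∧ ψ) (_ , x) (inj₂ y)      = disjoint-XC ρ ψ x y
      disjoint-XC ρ (`∀ φ) x (m , y)               = disjoint-XC (ext ρ m) φ (x m) y

      disjoint-CX : (ρ : Env n) (φ : Fml n) → Tr C ρ φ → Fa X ρ φ → ⊥
      disjoint-CX ρ (s `≡ t) x y                   = y x
      disjoint-CX ρ (`True t) x (inj₁ y)           = y (C-codes x)
      disjoint-CX ρ (`True t) x (inj₂ (ψ , e , y)) = clash-CX x y ψ (sym e) refl
      disjoint-CX ρ (`¬ φ) x y                     = disjoint-XC ρ φ y x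
      disjoint-CX ρ (φ `∧ ψ) (x , _) (inj₁ y)      = disjoint-CX ρ φ x y
      disjoint-CX ρ (φ `∧ ψ) (_ , x) (inj₂ y)      = disjoint-CX ρ ψ x y
      disjoint-CX ρ (`∀ φ) x (m , y)               = disjoint-CX (ext ρ m) φ (x m) y

      disjoint-CC : (ρ : Env n) (φ : Fml n) → Tr C ρ φ → Fa C ρ φ → ⊥
      disjoint-CC ρ (s `≡ t) x y                   = y x
      disjoint-CC ρ (`True t) x (inj₁ y)           = y (C-codes x)
      disjoint-CC ρ (`True t) x (inj₂ (ψ , e , y)) = clash-CC x y ψ (sym e) refl
      disjoint-CC ρ (`¬ φ) x y                     = disjoint-CC ρ φ y x
      disjoint-CC ρ (φ `∧ ψ) (x , _) (inj₁ y)      = disjoint-CC ρ φ x y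
      disjoint-CC ρ (φ `∧ ψ) (_ , x) (inj₂ y)      = disjoint-CC ρ ψ x y
      disjoint-CC ρ (`∀ φ) x (m , y)               = disjoint-CC (ext ρ m) φ (x m) y

      clash-XC : ∀ {k k′} → X k → C k′ → (φ : Sentence) → k ≡ ⌜ φ ⌝ → k′ ≡ ⌜ `¬ φ ⌝ → ⊥
      clash-XC x (seed y)   φ refl refl = consistent φ (x , y)
      clash-XC x (jump ψ t) φ refl e
        with refl ← ⌜⌝-injective ψ (`¬ φ) e = disjoint-XC _ φ (member⇒true onlyTrueCodes φ x) t

      clash-CX : ∀ {k k′} → C k → X k′ → (φ : Sentence) → k ≡ ⌜ φ ⌝ → k′ ≡ ⌜ `¬ φ ⌝ → ⊥
      clash-CX (seed x)   y φ refl refl = consistent φ (x , y)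
      clash-CX (jump ψ t) y φ e    refl
        with refl ← ⌜⌝-injective ψ φ e = disjoint-CX _ φ t (member⇒true onlyTrueCodes (`¬ φ) y)

      clash-CC : ∀ {k k′} → C k → C k′ → (φ : Sentence) → k ≡ ⌜ φ ⌝ → k′ ≡ ⌜ `¬ φ ⌝ → ⊥
      clash-CC (seed x)   y          φ e e′ = clash-XC x y φ e e′
      clash-CC (jump ψ t) (seed y)   φ e e′ = clash-CX (jump ψ t) y φ e e′
      clash-CC (jump ψ t) (jump ψ′ t′) φ e e′
        with refl ← ⌜⌝-injective ψ φ e | refl ← ⌜⌝-injective ψ′ (`¬ φ) e′ = disjoint-CC _ φ t t′

  Cl-disjoint : (ρ : Env n) (φ : Fml n) → Tr (Cl X) ρ φ → Fa (Cl X) ρ φ → ⊥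
  Cl-disjoint = disjoint-CC

  Cl-isFixedPoint : IsFixedPoint (Cl X)
  Cl-isFixedPoint = record
    { onlyTrueCodes = only
    ; allTrueCodes  = jump
    ; consistent    = λ φ (x , y) → clash-CC x y φ refl refl
    }
    where
    only : OnlyTrueCodes (Cl X)
    only _ (seed x)   = let φ , e , t = onlyTrueCodes _ x in φ , e , Tr-mono seed _ φ t
    only _ (jump φ t) = φ , refl , t

  closure-fix : FIX
  closure-fix = Cl X , Cl-isFixedPoint

∅-sound : Sound ∅
∅-sound = record { onlyTrueCodes = λ _ () ; consistent = λ _ () }

lfp : FIX
lfp = closure-fix ∅-sound

module _ (w : FIX) where
  open IsFixedPoint (proj₂ w)

  private
    W = proj₁ w
    W-sound : Sound W
    W-sound = record { onlyTrueCodes = onlyTrueCodes ; consistent = consistent }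

  fix-disjoint : (ρ : Env n) (φ : Fml n) → Tr W ρ φ → Fa W ρ φ → ⊥
  fix-disjoint ρ φ t f = Cl-disjoint W-sound ρ φ (Tr-mono seed ρ φ t) (Fa-mono seed ρ φ f)

  lfp-true : (φ : Sentence) → TrueIn (proj₁ lfp) φ → TrueIn W φ
  lfp-true = Tr-mono (Cl-least (λ ()) allTrueCodes) _

  lfp-false : (φ : Sentence) → FalseIn (proj₁ lfp) φ → FalseIn W φ
  lfp-false = Fa-mono (Cl-least (λ ()) allTrueCodes) _

  fix-member⇔true : (φ : Sentence) → W ⌜ φ ⌝ ⇔ TrueIn W φ
  fix-member⇔true φ = mk⇔ (member⇒true onlyTrueCodes φ) (allTrueCodes φ)

  fix-falseCode⇔false : (φ : Sentence) → FalseCode W ⌜ φ ⌝ ⇔ FalseIn W φ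
  fix-falseCode⇔false φ = mk⇔ ⟹ (λ f → inj₂ (φ , refl , allTrueCodes (`¬ φ) f))
    where
    ⟹ : FalseCode W ⌜ φ ⌝ → FalseIn W φ
    ⟹ (inj₁ notCode) = contradiction (φ , refl) notCode
    ⟹ (inj₂ (ψ , e , x)) with refl ← ⌜⌝-injective ψ φ e = member⇒true onlyTrueCodes (`¬ ψ) x

decide : ExcludedMiddle (lsuc 0ℓ) → (P : Set) → Dec P
decide em P = map′ lower lift em

So-not : ∀ {ℓ} {P : Set ℓ} {b} → P ⇔ So b → (¬ P) ⇔ So (not b)
So-not {b = true}  P⇔ = mk⇔ (λ ¬p → ¬p (from P⇔ _)) λ ()
So-not {b = false} P⇔ = mk⇔ _ λ _ p → to P⇔ p

module _ (em : ExcludedMiddle (lsuc 0ℓ)) (w : FIX) (⋆ : Realization) (σ : ℕ → MF) where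

  valuation : ℕ → Bool
  valuation i = isYes (em {w ⊩[ ⋆ ] σ i})

  ⊩-substP : ∀ a → (w ⊩[ ⋆ ] substP σ a) ⇔ So (evalP valuation a)
  ⊩-substP (p i)    = mk⇔ (fromWitness {a? = em}) (toWitness {a? = em})
  ⊩-substP (¬ₚ a)   = So-not (⊩-substP a)
  ⊩-substP (a ∧ₚ b) = ⇔-sym T-∧ ⇔-∘ (⊩-substP a ×-⇔ ⊩-substP b)

soundness : ExcludedMiddle (lsuc 0ℓ) → ∀ {A} → ⊢S5CG A → FIX⊩ A
soundness em (taut a tautology σ) ⋆ w =
  from (⊩-substP em w ⋆ σ a) (from T-≡ (tautology _))
soundness em (K A B) ⋆ w (□A⇒B , ¬[□A⇒□B]) =
  ¬[□A⇒□B] λ (□A , ¬□B) → ¬□B λ v → em⇒dne em λ ¬B → □A⇒B v (□A v , ¬B)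
soundness em (Tax A) ⋆ w (□A , ¬A) = ¬A (□A w)
soundness em (5ax A) ⋆ w (◇A , ¬□◇A) = ¬□◇A λ _ → ◇A
soundness em (con y) ⋆ w (lift t , lift f) = fix-disjoint w _ (⋆ y) t f
soundness em (ground y) ⋆ w ((◇T , ◇F) , ¬◇N) = ¬◇N λ □¬N → □¬N lfp
  -- y⋆ is neither true nor false in lfp, which lies below the fixed points witnessing ◇T and ◇F.
  ( (λ (lift t) → ◇F λ v (lift f) → fix-disjoint v _ (⋆ y) (lfp-true v (⋆ y) t) f)
  , (λ (lift f) → ◇T λ v (lift t) → fix-disjoint v _ (⋆ y) t (lfp-false v (⋆ y) f)))
soundness em (mp A⇒B A) ⋆ w = em⇒dne em λ ¬B → soundness em A⇒B ⋆ w (soundness em A ⋆ w , ¬B)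
soundness em (nec A) ⋆ w v = soundness em A ⋆ v

module _ where
  open import Data.Nat using (_!; s≤s⁻¹)
  open import Data.Nat.Properties
  open import Data.Nat.Divisibility
  open import Data.Nat.Coprimality using (Coprime; coprime-divisor; coprime-Bézout)
  open import Data.Nat.GCD using (module Bézout)
  open import Data.Nat.DivMod
  open import Data.Nat.Tactic.RingSolver using (solve-∀)

  coprime-* : ∀ {x y m} → Coprime x m → Coprime y m → Coprime (x * y) m
  coprime-* {x} cx cy {d} (d∣xy , d∣m) = cy (coprime-divisor d-x-coprime d∣xy , d∣m)
    where
    d-x-coprime : Coprime d x
    d-x-coprime (e∣d , e∣x) = cx (e∣x , ∣-trans e∣d d∣m)

  linear-congruence : ∀ {Q m} → Coprime Q (suc m) → ∀ a r →
                      Σ ℕ λ t → (a + Q * t) % suc m ≡ r % suc m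
  linear-congruence {Q} {m} c a r with coprime-Bézout c
  -- x is an inverse of Q and z ≡ r - a modulo m + 1.
  ... | Bézout.+- x y xQ≡1+ym = x * z , (begin
      (a + Q * (x * z)) % suc m         ≡⟨ cong (_% suc m) shifted ⟩
      (r + (a + y * z) * suc m) % suc m ≡⟨ [m+kn]%n≡m%n r (a + y * z) (suc m) ⟩
      r % suc m                         ∎)
    where
    open ≡-Reasoning
    z = r + m * a
    reassoc : ∀ Q x z → Q * (x * z) ≡ (x * Q) * z
    reassoc = solve-∀
    expand : ∀ a y m r → a + (1 + y * suc m) * (r + m * a) ≡ r + (a + y * (r + m * a)) * suc m
    expand = solve-∀
    shifted : a + Q * (x * z) ≡ r + (a + y * z) * suc m
    shifted = begin
      a + Q * (x * z)         ≡⟨ cong (a +_) (reassoc Q x z) ⟩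
      a + (x * Q) * z         ≡⟨ cong (λ v → a + v * z) (sym xQ≡1+ym) ⟩
      a + (1 + y * suc m) * z ≡⟨ expand a y m r ⟩
      r + (a + y * z) * suc m ∎
  -- x is minus an inverse of Q and z ≡ a - r modulo m + 1.
  ... | Bézout.-+ x y 1+xQ≡ym = x * z , (begin
      (a + Q * (x * z)) % suc m             ≡⟨ sym ([m+kn]%n≡m%n (a + Q * (x * z)) r (suc m)) ⟩
      (a + Q * (x * z) + r * suc m) % suc m ≡⟨ cong (_% suc m) shifted ⟩
      (r + (y * z) * suc m) % suc m         ≡⟨ [m+kn]%n≡m%n r (y * z) (suc m) ⟩
      r % suc m                             ∎)
    where
    open ≡-Reasoning
    z = a + m * r
    regroup : ∀ a Q x z r m → a + Q * (x * z) + r * suc m + z ≡ (1 + x * Q) * z + a + r * suc m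
    regroup = solve-∀
    expand : ∀ y m a r → y * suc m * (a + m * r) + a + r * suc m ≡ r + (y * (a + m * r)) * suc m + (a + m * r)
    expand = solve-∀
    shifted : a + Q * (x * z) + r * suc m ≡ r + (y * z) * suc m
    shifted = +-cancelʳ-≡ z _ _ (begin
      a + Q * (x * z) + r * suc m + z ≡⟨ regroup a Q x z r m ⟩
      (1 + x * Q) * z + a + r * suc m ≡⟨ cong (λ v → v * z + a + r * suc m) 1+xQ≡ym ⟩
      y * suc m * z + a + r * suc m   ≡⟨ expand y m a r ⟩
      r + (y * z) * suc m + z         ∎)

  module _ (m : ℕ → ℕ) where

    ∏-moduli : ℕ → ℕ
    ∏-moduli zero    = 1
    ∏-moduli (suc k) = ∏-moduli k * suc (m k)

    modulus∣∏ : ∀ {i k} → i < k → suc (m i) ∣ ∏-moduli k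
    modulus∣∏ {i} {suc k} i<1+k with m≤n⇒m<n∨m≡n (s≤s⁻¹ i<1+k)
    ... | inj₁ i<k  = ∣m⇒∣m*n (suc (m k)) (modulus∣∏ i<k)
    ... | inj₂ refl = n∣m*n (∏-moduli i)

    ∏-coprime : ∀ k {j} → (∀ {i} → i < k → Coprime (suc (m i)) (suc (m j))) →
                Coprime (∏-moduli k) (suc (m j))
    ∏-coprime zero    _        (d∣1 , _) = ∣1⇒≡1 d∣1
    ∏-coprime (suc k) coprime = coprime-* (∏-coprime k (coprime ∘ m<n⇒m<1+n)) (coprime (n<1+n k))

    chinese-remainder : ∀ k → (∀ {i j} → i < j → j < k → Coprime (suc (m i)) (suc (m j))) →
                        (s : ℕ → ℕ) → Σ ℕ λ a → ∀ i → i < k → a % suc (m i) ≡ s i % suc (m i)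
    chinese-remainder zero    _       s = 0 , λ _ ()
    chinese-remainder (suc k) coprime s = a + ∏-moduli k * t , solves
      where
      a-solves = chinese-remainder k (λ i<j j<k → coprime i<j (m<n⇒m<1+n j<k)) s
      a = proj₁ a-solves
      t-solves = linear-congruence (∏-coprime k (λ i<k → coprime i<k (n<1+n k))) a (s k)
      t = proj₁ t-solves
      solves : ∀ i → i < suc k → (a + ∏-moduli k * t) % suc (m i) ≡ s i % suc (m i)
      solves i i<1+k with m≤n⇒m<n∨m≡n (s≤s⁻¹ i<1+k)
      ... | inj₁ i<k  = trans (%-remove-+ʳ a (∣m⇒∣m*n t (modulus∣∏ i<k))) (proj₂ a-solves i i<k)
      ... | inj₂ refl = proj₂ t-solves

  β-modulus : ℕ → ℕ → ℕ
  β-modulus b i = suc (suc i * b)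

  β : ℕ → ℕ → ℕ → ℕ
  β a b i = a % β-modulus b i

  β-modulus-coprime : ∀ b i → Coprime (β-modulus b i) b
  β-modulus-coprime b i {d} (d∣M , d∣b) =
    ∣1⇒≡1 (∣m+n∣m⇒∣n (subst (d ∣_) (+-comm 1 (suc i * b)) d∣M) (∣n⇒∣m*n (suc i) d∣b))

  -- A common divisor d of both moduli divides (j - i) b and is coprime to b, so d ∣ j - i ∣ b.
  β-moduli-coprime : ∀ {b u} → (∀ d → 1 ≤ d → d ≤ u → d ∣ b) →
                     ∀ {i j} → i < j → j ≤ u → Coprime (β-modulus b i) (β-modulus b j)
  β-moduli-coprime {b} {u} small∣b {i} {j} i<j j≤u {d} (d∣Mi , d∣Mj) =
    β-modulus-coprime b i (d∣Mi , ∣-trans d∣k (small∣b k (m<n⇒0<n∸m i<j) (≤-trans (m∸n≤m j i) j≤u)))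
    where
    open ≡-Reasoning
    k = j ∸ i
    Mj≡Mi+kb : β-modulus b j ≡ β-modulus b i + k * b
    Mj≡Mi+kb = begin
      suc (suc j * b)           ≡⟨ cong (λ v → suc (suc v * b)) (sym (m+[n∸m]≡n (<⇒≤ i<j))) ⟩
      suc (suc (i + k) * b)     ≡⟨ cong suc (distrib i k b) ⟩
      suc (suc i * b + k * b)   ∎
      where
      distrib : ∀ i k b → suc (i + k) * b ≡ suc i * b + k * b
      distrib = solve-∀
    d∣k : d ∣ k
    d∣k = coprime-divisor (λ (e∣d , e∣b) → β-modulus-coprime b i (∣-trans e∣d d∣Mi , e∣b))
            (subst (d ∣_) (*-comm k b) (∣m+n∣m⇒∣n (subst (d ∣_) Mj≡Mi+kb d∣Mj) d∣Mi))

  private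
    sum≤ : (ℕ → ℕ) → ℕ → ℕ
    sum≤ s zero    = s 0
    sum≤ s (suc u) = sum≤ s u + s (suc u)

    ≤sum≤ : ∀ s {i u} → i ≤ u → s i ≤ sum≤ s u
    ≤sum≤ s {zero}  {zero}  _   = ≤-refl
    ≤sum≤ s {i}     {suc u} i≤u with m≤n⇒m<n∨m≡n i≤u
    ... | inj₁ i<1+u = ≤-trans (≤sum≤ s (s≤s⁻¹ i<1+u)) (m≤m+n _ _)
    ... | inj₂ refl  = m≤n+m _ _

  -- Gödel's choice of b makes the moduli pairwise coprime and larger than every s i.
  β-lemma : ∀ u (s : ℕ → ℕ) → Σ ℕ λ a → Σ ℕ λ b → ∀ i → i ≤ u → β a b i ≡ s i
  β-lemma u s = a , b , λ i i≤u → trans (a≡s i (s≤s i≤u)) (m<n⇒m%n≡m (s<M i≤u))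
    where
    b = u ! * suc (sum≤ s u)
    small∣b : ∀ d → 1 ≤ d → d ≤ u → d ∣ b
    small∣b (suc d) _ d≤u = ∣m⇒∣m*n (suc (sum≤ s u)) (∣-trans (m∣m*n (d !)) (m≤n⇒m!∣n! d≤u))
    crt = chinese-remainder (λ i → suc i * b) (suc u) (λ i<j j<1+u → β-moduli-coprime small∣b i<j (s≤s⁻¹ j<1+u)) s
    a = proj₁ crt
    a≡s = proj₂ crt
    s<M : ∀ {i} → i ≤ u → s i < β-modulus b i
    s<M {i} i≤u = s≤s (begin
      s i             ≤⟨ ≤sum≤ s i≤u ⟩
      sum≤ s u        ≤⟨ n≤1+n _ ⟩
      suc (sum≤ s u)  ≤⟨ m≤n*m (suc (sum≤ s u)) (u !) {{u !≢0}} ⟩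
      b               ≤⟨ m≤m+n b (i * b) ⟩
      suc i * b       ∎)
      where open ≤-Reasoning

`∃_ : Fml (suc n) → Fml n
`∃ φ = `¬ (`∀ (`¬ φ))

infixr 4 _`⇒_
_`⇒_ : Fml n → Fml n → Fml n
φ `⇒ ψ = `¬ (φ `∧ (`¬ ψ))

v₀ : Term (suc n)
v₁ : Term (2 + n)
v₂ : Term (3 + n)
v₃ : Term (4 + n)
v₄ : Term (5 + n)
v₀ = var Fin.zero
v₁ = var (Fin.suc Fin.zero)
v₂ = var (Fin.suc (Fin.suc Fin.zero))
v₃ = var (Fin.suc (Fin.suc (Fin.suc Fin.zero)))
v₄ = var (Fin.suc (Fin.suc (Fin.suc (Fin.suc Fin.zero))))

wk : Term n → Term (suc n)
wk (var i)  = var (Fin.suc i)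
wk `zero    = `zero
wk (`suc t) = `suc (wk t)
wk (s `+ t) = wk s `+ wk t
wk (s `* t) = wk s `* wk t

wk-sound : (t : Term n) (ρ : Env n) (m : ℕ) → ⟦ wk t ⟧ₜ (ext ρ m) ≡ ⟦ t ⟧ₜ ρ
wk-sound (var i)  ρ m = refl
wk-sound `zero    ρ m = refl
wk-sound (`suc t) ρ m = cong suc (wk-sound t ρ m)
wk-sound (s `+ t) ρ m = cong₂ _+_ (wk-sound s ρ m) (wk-sound t ρ m)
wk-sound (s `* t) ρ m = cong₂ _*_ (wk-sound s ρ m) (wk-sound t ρ m)

weaken : (k : ℕ) → Term n → Term (k + n)
weaken zero    t = t
weaken (suc k) t = wk (weaken k t)

extend : ∀ {k} → Env n → Vec ℕ k → Env (k + n)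
extend ρ []       = ρ
extend ρ (m ∷ ms) = ext (extend ρ ms) m

weaken-sound : ∀ {k} (t : Term n) (ρ : Env n) (ms : Vec ℕ k) → ⟦ weaken k t ⟧ₜ (extend ρ ms) ≡ ⟦ t ⟧ₜ ρ
weaken-sound t ρ []       = refl
weaken-sound t ρ (m ∷ ms) = trans (wk-sound (weaken _ t) (extend ρ ms) m) (weaken-sound t ρ ms)

num : ℕ → Term n
num zero    = `zero
num (suc k) = `suc (num k)

num-sound : ∀ k (ρ : Env n) → ⟦ num k ⟧ₜ ρ ≡ k
num-sound zero    ρ = refl
num-sound (suc k) ρ = cong suc (num-sound k ρ)

numcode : ℕ → ℕ
numcode k = ⌜ num {0} k ⌝ₜ

⌜num⌝ : ∀ k → ⌜ num {n} k ⌝ₜ ≡ numcode k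
⌜num⌝ zero    = refl
⌜num⌝ (suc k) = cong (pair 2) (⌜num⌝ k)

arithmetical : Fml n → Bool
arithmetical (_ `≡ _)  = true
arithmetical (`True _) = false
arithmetical (`¬ φ)    = arithmetical φ
arithmetical (φ `∧ ψ)  = arithmetical φ ∧ arithmetical ψ
arithmetical (`∀ φ)    = arithmetical φ

module _ {S : Pred ℕ 0ℓ} where

  arithmetical-disjoint : (ρ : Env n) (φ : Fml n) → So (arithmetical φ) → Tr S ρ φ → Fa S ρ φ → ⊥
  arithmetical-disjoint ρ (s `≡ t) _ x y = y x
  arithmetical-disjoint ρ (`¬ φ)   a x y = arithmetical-disjoint ρ φ a y x
  arithmetical-disjoint ρ (φ `∧ ψ) a (x , _) (inj₁ y) = arithmetical-disjoint ρ φ (proj₁ (to T-∧ a)) x y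
  arithmetical-disjoint ρ (φ `∧ ψ) a (_ , x) (inj₂ y) = arithmetical-disjoint ρ ψ (proj₂ (to T-∧ a)) x y
  arithmetical-disjoint ρ (`∀ φ)   a x (m , y) = arithmetical-disjoint (ext ρ m) φ a (x m) y

  arithmetical-bivalent : ExcludedMiddle (lsuc 0ℓ) → (ρ : Env n) (φ : Fml n) → So (arithmetical φ) →
                          Tr S ρ φ ⊎ Fa S ρ φ
  arithmetical-bivalent em ρ (s `≡ t) _ with ⟦ s ⟧ₜ ρ ≟ ⟦ t ⟧ₜ ρ
  ... | yes s≡t = inj₁ s≡t
  ... | no  s≢t = inj₂ s≢t
  arithmetical-bivalent em ρ (`¬ φ) a with arithmetical-bivalent em ρ φ a
  ... | inj₁ x = inj₂ x
  ... | inj₂ y = inj₁ y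
  arithmetical-bivalent em ρ (φ `∧ ψ) a
    with arithmetical-bivalent em ρ φ (proj₁ (to T-∧ a)) | arithmetical-bivalent em ρ ψ (proj₂ (to T-∧ a))
  ... | inj₁ x | inj₁ x′ = inj₁ (x , x′)
  ... | inj₂ y | _       = inj₂ (inj₁ y)
  ... | inj₁ _ | inj₂ y′ = inj₂ (inj₂ y′)
  arithmetical-bivalent em ρ (`∀ φ) a with decide em (Σ ℕ λ m → Fa S (ext ρ m) φ)
  ... | yes counterexample = inj₂ counterexample
  ... | no  none = inj₁ λ m → [ (λ x → x) , (λ y → contradiction (m , y) none) ]′
                                (arithmetical-bivalent em (ext ρ m) φ a)

_`<_ : Term n → Term n → Fml n
x `< y = `∃ ((wk x `+ `suc v₀) `≡ wk y)

-- 2 z = (x + y) (x + y + 1) + 2 y avoids the division hidden in pair.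
IsPair : Term n → Term n → Term n → Fml n
IsPair x y z = (z `+ z) `≡ (((x `+ y) `* `suc (x `+ y)) `+ (y `+ y))

β-modulusₜ : Term n → Term n → Term n
β-modulusₜ b i = `suc (`suc i `* b)

IsBeta : Term n → Term n → Term n → Term n → Fml n
IsBeta a b i r = `∃ ((wk a `≡ ((v₀ `* wk M) `+ wk r)) `∧ (wk r `< wk M))
  where
  M = β-modulusₜ b i

-- A β-coded sequence lists the codes of the numerals 0, 1, …, u.
NumcodeStep : Term n → Fml (3 + n)
NumcodeStep u = (v₀ `< weaken 3 u) `⇒
  `∃ (`∃ (IsBeta v₄ v₃ v₂ v₁ `∧ (IsBeta v₄ v₃ (`suc v₂) v₀ `∧ IsPair (num 2) v₁ v₀)))

IsNumcode : Term n → Term n → Fml n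
IsNumcode u c =
  `∃ (`∃ (IsBeta v₁ v₀ `zero (num 1) `∧ ((`∀ NumcodeStep u) `∧ IsBeta v₁ v₀ (weaken 2 u) (weaken 2 c))))

data CodeTree (n : ℕ) : Set where
  leaf : Term n → CodeTree n
  node : CodeTree n → CodeTree n → CodeTree n

⟦_⟧ᶜ : CodeTree n → Env n → ℕ
⟦ leaf t ⟧ᶜ   ρ = ⟦ t ⟧ₜ ρ
⟦ node l r ⟧ᶜ ρ = pair (⟦ l ⟧ᶜ ρ) (⟦ r ⟧ᶜ ρ)

-- The tree lives in the outer context while the formula sits under k further binders.
IsCode : (k : ℕ) → CodeTree n → Term (k + n) → Fml (k + n)
IsCode k (leaf t)   z = z `≡ weaken k t
IsCode k (node l r) z =
  `∃ (`∃ (IsCode (2 + k) l v₁ `∧ (IsCode (2 + k) r v₀ `∧ IsPair v₁ v₀ (weaken 2 z))))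

-- The code of Diag B from u = ⌜ B ⌝ and c = ⌜ num ⌜ B ⌝ ⌝ₜ; note ⌜ v₀ ⌝ₜ = pair 0 0.
diagTree : Term n → Term n → CodeTree n
diagTree u c =
  node (leaf (num 4)) (node (leaf (num 2)) (node (leaf (num 3))
    (node (node (leaf (num 0)) (node (node (leaf (num 0)) (leaf (num 0))) (leaf c)))
          (node (leaf (num 2)) (leaf u)))))

IsDiagCode : Term n → Term n → Fml n
IsDiagCode u m = `∃ (IsNumcode (wk u) v₀ `∧ IsCode 0 (diagTree (wk u) v₀) (wk m))

Diag : Fml 1 → Sentence
Diag B = `∀ ((v₀ `≡ num ⌜ B ⌝) `⇒ B)

-- Opaque because normalising the nested Cantor pairs, whose constant parts are in the
-- millions, makes conversion checking diverge.
opaque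
  diagCodeWith : ℕ → ℕ → ℕ
  diagCodeWith u c = pair 4 (pair 2 (pair 3 (pair (pair 0 (pair (pair 0 0) c)) (pair 2 u))))

  ⟦diagTree⟧ : (ρ : Env n) (u c : Term n) → ⟦ diagTree u c ⟧ᶜ ρ ≡ diagCodeWith (⟦ u ⟧ₜ ρ) (⟦ c ⟧ₜ ρ)
  ⟦diagTree⟧ ρ u c = refl

  ⌜Diag⌝ : (B : Fml 1) → ⌜ Diag B ⌝ ≡ diagCodeWith ⌜ B ⌝ (numcode ⌜ B ⌝)
  ⌜Diag⌝ B = cong (diagCodeWith ⌜ B ⌝) {x = ⌜ num {1} ⌜ B ⌝ ⌝ₜ} {y = numcode ⌜ B ⌝} (⌜num⌝ ⌜ B ⌝)

diagCode : ℕ → ℕ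
diagCode u = diagCodeWith u (numcode u)

pair-double : ∀ a b → pair a b + pair a b ≡ (a + b) * suc (a + b) + (b + b)
pair-double a b = begin
  (tri (a + b) + b) + (tri (a + b) + b) ≡⟨ interchange (tri (a + b)) b ⟩
  (tri (a + b) + tri (a + b)) + (b + b) ≡⟨ cong (_+ (b + b)) (tri-double (a + b)) ⟩
  (a + b) * suc (a + b) + (b + b)       ∎
  where
  open ≡-Reasoning
  interchange : ∀ x y → (x + y) + (x + y) ≡ (x + x) + (y + y)
  interchange = solve-∀
  tri-double : ∀ s → tri s + tri s ≡ s * suc s
  tri-double zero    = refl
  tri-double (suc s) = begin
    (suc s + tri s) + (suc s + tri s) ≡⟨ interchange (suc s) (tri s) ⟩
    (suc s + suc s) + (tri s + tri s) ≡⟨ cong ((suc s + suc s) +_) (tri-double s) ⟩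
    (suc s + suc s) + s * suc s       ≡⟨ step s ⟩
    suc s * suc (suc s)               ∎
    where
    step : ∀ s → (suc s + suc s) + s * suc s ≡ suc s * suc (suc s)
    step = solve-∀

double-injective : ∀ {a b} → a + a ≡ b + b → a ≡ b
double-injective {a} {b} e = trans (n≡⌊n+n/2⌋ a) (trans (cong ⌊_/2⌋ e) (sym (n≡⌊n+n/2⌋ b)))

mod-unique : ∀ {a q r M} .{{_ : NonZero M}} → a ≡ q * M + r → r < M → r ≡ a % M
mod-unique {a} {q} {r} {M} a≡qM+r r<M = sym (begin
  a % M           ≡⟨ cong (_% M) (trans a≡qM+r (+-comm (q * M) r)) ⟩
  (r + q * M) % M ≡⟨ [m+kn]%n≡m%n r q M ⟩
  r % M           ≡⟨ m<n⇒m%n≡m r<M ⟩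
  r               ∎)
  where open ≡-Reasoning

module _ {S : Pred ℕ 0ℓ} where

  Tr-< : (ρ : Env n) (x y : Term n) → Tr S ρ (x `< y) ⇔ (⟦ x ⟧ₜ ρ < ⟦ y ⟧ₜ ρ)
  Tr-< ρ x y = mk⇔ ⟹ ⟸
    where
    ⟹ : Tr S ρ (x `< y) → ⟦ x ⟧ₜ ρ < ⟦ y ⟧ₜ ρ
    ⟹ (d , e) rewrite wk-sound x ρ d | wk-sound y ρ d = ≤-trans (m<m+n _ (s≤s z≤n)) (≤-reflexive e)
    ⟸ : ⟦ x ⟧ₜ ρ < ⟦ y ⟧ₜ ρ → Tr S ρ (x `< y)
    ⟸ x<y = d , (begin
      ⟦ wk x ⟧ₜ (ext ρ d) + suc d ≡⟨ cong (_+ suc d) (wk-sound x ρ d) ⟩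
      ⟦ x ⟧ₜ ρ + suc d             ≡⟨ +-suc _ d ⟩
      suc (⟦ x ⟧ₜ ρ + d)           ≡⟨ m+[n∸m]≡n x<y ⟩
      ⟦ y ⟧ₜ ρ                     ≡⟨ sym (wk-sound y ρ d) ⟩
      ⟦ wk y ⟧ₜ (ext ρ d)          ∎)
      where
      open ≡-Reasoning
      d = ⟦ y ⟧ₜ ρ ∸ suc (⟦ x ⟧ₜ ρ)

  Fa-< : (ρ : Env n) (x y : Term n) → Fa S ρ (x `< y) ⇔ (¬ ⟦ x ⟧ₜ ρ < ⟦ y ⟧ₜ ρ)
  Fa-< ρ x y = mk⇔ (λ f x<y → let d , e = from (Tr-< ρ x y) x<y in f d e)
                   (λ x≮y d e → x≮y (to (Tr-< ρ x y) (d , e)))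

  Tr-IsPair : (ρ : Env n) (x y z : Term n) →
              Tr S ρ (IsPair x y z) ⇔ (⟦ z ⟧ₜ ρ ≡ pair (⟦ x ⟧ₜ ρ) (⟦ y ⟧ₜ ρ))
  Tr-IsPair ρ x y z = mk⇔
    (λ e → double-injective (trans e (sym (pair-double (⟦ x ⟧ₜ ρ) (⟦ y ⟧ₜ ρ)))))
    (λ e → trans (cong₂ _+_ e e) (pair-double (⟦ x ⟧ₜ ρ) (⟦ y ⟧ₜ ρ)))

  Tr-IsBeta : (ρ : Env n) (a b i r : Term n) →
              Tr S ρ (IsBeta a b i r) ⇔ (⟦ r ⟧ₜ ρ ≡ β (⟦ a ⟧ₜ ρ) (⟦ b ⟧ₜ ρ) (⟦ i ⟧ₜ ρ))
  Tr-IsBeta ρ a b i r = mk⇔ ⟹ ⟸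
    where
    M = β-modulusₜ b i
    ⟹ : Tr S ρ (IsBeta a b i r) → ⟦ r ⟧ₜ ρ ≡ β (⟦ a ⟧ₜ ρ) (⟦ b ⟧ₜ ρ) (⟦ i ⟧ₜ ρ)
    ⟹ (q , e , r<M) = mod-unique {q = q} a≡qM+r
      (subst₂ _<_ (wk-sound r ρ q) (wk-sound M ρ q) (to (Tr-< (ext ρ q) (wk r) (wk M)) r<M))
      where
      a≡qM+r : ⟦ a ⟧ₜ ρ ≡ q * ⟦ M ⟧ₜ ρ + ⟦ r ⟧ₜ ρ
      a≡qM+r = trans (sym (wk-sound a ρ q))
        (trans e (cong₂ (λ u v → q * u + v) (wk-sound M ρ q) (wk-sound r ρ q)))
    ⟸ : ⟦ r ⟧ₜ ρ ≡ β (⟦ a ⟧ₜ ρ) (⟦ b ⟧ₜ ρ) (⟦ i ⟧ₜ ρ) → Tr S ρ (IsBeta a b i r)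
    ⟸ r≡β = q , a≡qM+r , from (Tr-< (ext ρ q) (wk r) (wk M)) r<M
      where
      open ≡-Reasoning
      A = ⟦ a ⟧ₜ ρ
      m = ⟦ M ⟧ₜ ρ
      q = A / m
      a≡qM+r : ⟦ wk a ⟧ₜ (ext ρ q) ≡ q * ⟦ wk M ⟧ₜ (ext ρ q) + ⟦ wk r ⟧ₜ (ext ρ q)
      a≡qM+r = begin
        ⟦ wk a ⟧ₜ (ext ρ q)                           ≡⟨ wk-sound a ρ q ⟩
        A                                             ≡⟨ m≡m%n+[m/n]*n A m ⟩
        A % m + q * m                                 ≡⟨ +-comm (A % m) (q * m) ⟩
        q * m + A % m                                 ≡⟨ cong₂ (λ u v → q * u + v)
                                                           (sym (wk-sound M ρ q)) (sym (trans (wk-sound r ρ q) r≡β)) ⟩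
        q * ⟦ wk M ⟧ₜ (ext ρ q) + ⟦ wk r ⟧ₜ (ext ρ q) ∎
      r<M : ⟦ wk r ⟧ₜ (ext ρ q) < ⟦ wk M ⟧ₜ (ext ρ q)
      r<M = subst₂ _<_ (sym (trans (wk-sound r ρ q) r≡β)) (sym (wk-sound M ρ q)) (m%n<n A m)

  Tr-NumcodeStep : (ρ : Env n) (u : Term n) (a b i : ℕ) →
                   Tr S (extend ρ (i ∷ b ∷ a ∷ [])) (NumcodeStep u) ⇔
                   (i < ⟦ u ⟧ₜ ρ → β a b (suc i) ≡ pair 2 (β a b i))
  Tr-NumcodeStep ρ u a b i = mk⇔ ⟹ (λ h → ⟸ h (i <? ⟦ u ⟧ₜ ρ))
    where
    ρ₃ = extend ρ (i ∷ b ∷ a ∷ [])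
    ρ₅ : ℕ → ℕ → Env (5 + _)
    ρ₅ r r′ = extend ρ (r′ ∷ r ∷ i ∷ b ∷ a ∷ [])
    i<u⇔ : i < ⟦ weaken 3 u ⟧ₜ ρ₃ ⇔ i < ⟦ u ⟧ₜ ρ
    i<u⇔ = mk⇔ (subst (i <_) (weaken-sound u ρ (i ∷ b ∷ a ∷ [])))
                (subst (i <_) (sym (weaken-sound u ρ (i ∷ b ∷ a ∷ []))))

    ⟹ : Tr S ρ₃ (NumcodeStep u) → i < ⟦ u ⟧ₜ ρ → β a b (suc i) ≡ pair 2 (β a b i)
    ⟹ (inj₁ i≮u) i<u = contradiction (from i<u⇔ i<u) (to (Fa-< ρ₃ v₀ (weaken 3 u)) i≮u)
    ⟹ (inj₂ (r , r′ , r≡β , r′≡β , r′≡2r)) _ = begin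
      β a b (suc i) ≡⟨ sym (to (Tr-IsBeta (ρ₅ r r′) v₄ v₃ (`suc v₂) v₀) r′≡β) ⟩
      r′            ≡⟨ to (Tr-IsPair (ρ₅ r r′) (num 2) v₁ v₀) r′≡2r ⟩
      pair 2 r      ≡⟨ cong (pair 2) (to (Tr-IsBeta (ρ₅ r r′) v₄ v₃ v₂ v₁) r≡β) ⟩
      pair 2 (β a b i) ∎
      where open ≡-Reasoning

    ⟸ : (i < ⟦ u ⟧ₜ ρ → β a b (suc i) ≡ pair 2 (β a b i)) → Dec (i < ⟦ u ⟧ₜ ρ) →
        Tr S ρ₃ (NumcodeStep u)
    ⟸ _    (no i≮u)  = inj₁ (from (Fa-< ρ₃ v₀ (weaken 3 u)) (i≮u ∘ to i<u⇔))
    ⟸ step (yes i<u) = inj₂ (r , r′ ,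
      from (Tr-IsBeta (ρ₅ r r′) v₄ v₃ v₂ v₁) refl ,
      from (Tr-IsBeta (ρ₅ r r′) v₄ v₃ (`suc v₂) v₀) refl ,
      from (Tr-IsPair (ρ₅ r r′) (num 2) v₁ v₀) (step i<u))
      where
      r  = β a b i
      r′ = β a b (suc i)

  Tr-IsNumcode : (ρ : Env n) (u c : Term n) → Tr S ρ (IsNumcode u c) ⇔ (⟦ c ⟧ₜ ρ ≡ numcode (⟦ u ⟧ₜ ρ))
  Tr-IsNumcode ρ u c = mk⇔ ⟹ ⟸
    where
    U = ⟦ u ⟧ₜ ρ
    ρ₂ : ℕ → ℕ → Env (2 + _)
    ρ₂ a b = extend ρ (b ∷ a ∷ [])

    βU≡c⇔ : ∀ a b → Tr S (ρ₂ a b) (IsBeta v₁ v₀ (weaken 2 u) (weaken 2 c)) ⇔ (⟦ c ⟧ₜ ρ ≡ β a b U)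
    βU≡c⇔ a b = mk⇔
      (λ h → trans (sym (weaken-sound c ρ ms)) (trans (to (Tr-IsBeta (ρ₂ a b) v₁ v₀ (weaken 2 u) (weaken 2 c)) h)
               (cong (β a b) (weaken-sound u ρ ms))))
      (λ e → from (Tr-IsBeta (ρ₂ a b) v₁ v₀ (weaken 2 u) (weaken 2 c)) (trans (weaken-sound c ρ ms)
               (trans e (cong (β a b) (sym (weaken-sound u ρ ms))))))
      where
      ms = b ∷ a ∷ []

    ⟹ : Tr S ρ (IsNumcode u c) → ⟦ c ⟧ₜ ρ ≡ numcode U
    ⟹ (a , b , β₀ , steps , βᵤ) = trans (to (βU≡c⇔ a b) βᵤ) (β≡numcode U ≤-refl)
      where
      β≡numcode : ∀ i → i ≤ U → β a b i ≡ numcode i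
      β≡numcode zero    _   = sym (to (Tr-IsBeta (ρ₂ a b) v₁ v₀ `zero (num 1)) β₀)
      β≡numcode (suc i) i<U = trans (to (Tr-NumcodeStep ρ u a b i) (steps i) i<U)
                                    (cong (pair 2) (β≡numcode i (<⇒≤ i<U)))

    ⟸ : ⟦ c ⟧ₜ ρ ≡ numcode U → Tr S ρ (IsNumcode u c)
    ⟸ c≡numcode = a , b ,
      from (Tr-IsBeta (ρ₂ a b) v₁ v₀ `zero (num 1)) (sym (β≡numcode 0 z≤n)) ,
      (λ i → from (Tr-NumcodeStep ρ u a b i) λ i<U →
               trans (β≡numcode (suc i) i<U) (cong (pair 2) (sym (β≡numcode i (<⇒≤ i<U))))) ,
      from (βU≡c⇔ a b) (trans c≡numcode (sym (β≡numcode U ≤-refl)))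
      where
      a-b-β = β-lemma U numcode
      a = proj₁ a-b-β
      b = proj₁ (proj₂ a-b-β)
      β≡numcode : ∀ i → i ≤ U → β a b i ≡ numcode i
      β≡numcode = proj₂ (proj₂ a-b-β)

  Tr-IsCode : ∀ {k} (ρ : Env n) (ms : Vec ℕ k) (e : CodeTree n) (z : Term (k + n)) →
              Tr S (extend ρ ms) (IsCode k e z) ⇔ (⟦ z ⟧ₜ (extend ρ ms) ≡ ⟦ e ⟧ᶜ ρ)
  Tr-IsCode ρ ms (leaf t) z =
    mk⇔ (λ z≡t → trans z≡t (weaken-sound t ρ ms)) (λ z≡t → trans z≡t (sym (weaken-sound t ρ ms)))
  Tr-IsCode ρ ms (node l r) z = mk⇔ ⟹ ⟸
    where
    ⟹ : Tr S (extend ρ ms) (IsCode _ (node l r) z) → ⟦ z ⟧ₜ (extend ρ ms) ≡ ⟦ node l r ⟧ᶜ ρ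
    ⟹ (x , y , x≡l , y≡r , z≡xy) = begin
      ⟦ z ⟧ₜ (extend ρ ms)                    ≡⟨ sym (weaken-sound z (extend ρ ms) (y ∷ x ∷ [])) ⟩
      ⟦ weaken 2 z ⟧ₜ (extend ρ (y ∷ x ∷ ms)) ≡⟨ to (Tr-IsPair (extend ρ (y ∷ x ∷ ms)) v₁ v₀ (weaken 2 z)) z≡xy ⟩
      pair x y                                ≡⟨ cong₂ pair (to (Tr-IsCode ρ (y ∷ x ∷ ms) l v₁) x≡l)
                                                            (to (Tr-IsCode ρ (y ∷ x ∷ ms) r v₀) y≡r) ⟩
      ⟦ node l r ⟧ᶜ ρ                         ∎
      where open ≡-Reasoning
    ⟸ : ⟦ z ⟧ₜ (extend ρ ms) ≡ ⟦ node l r ⟧ᶜ ρ → Tr S (extend ρ ms) (IsCode _ (node l r) z)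
    ⟸ z≡lr = x , y , from (Tr-IsCode ρ ms′ l v₁) refl , from (Tr-IsCode ρ ms′ r v₀) refl ,
      from (Tr-IsPair (extend ρ ms′) v₁ v₀ (weaken 2 z)) (trans (weaken-sound z (extend ρ ms) (y ∷ x ∷ [])) z≡lr)
      where
      x = ⟦ l ⟧ᶜ ρ
      y = ⟦ r ⟧ᶜ ρ
      ms′ = y ∷ x ∷ ms

  Tr-IsDiagCode : (ρ : Env n) (u m : Term n) → Tr S ρ (IsDiagCode u m) ⇔ (⟦ m ⟧ₜ ρ ≡ diagCode (⟦ u ⟧ₜ ρ))
  Tr-IsDiagCode ρ u m = mk⇔ ⟹ ⟸
    where
    U = ⟦ u ⟧ₜ ρ
    ⟹ : Tr S ρ (IsDiagCode u m) → ⟦ m ⟧ₜ ρ ≡ diagCode U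
    ⟹ (c , c≡numcode , m≡tree) = begin
      ⟦ m ⟧ₜ ρ                             ≡⟨ sym (wk-sound m ρ c) ⟩
      ⟦ wk m ⟧ₜ (ext ρ c)                  ≡⟨ to (Tr-IsCode (ext ρ c) [] (diagTree (wk u) v₀) (wk m)) m≡tree ⟩
      ⟦ diagTree (wk u) v₀ ⟧ᶜ (ext ρ c) ≡⟨ ⟦diagTree⟧ (ext ρ c) (wk u) v₀ ⟩
      diagCodeWith (⟦ wk u ⟧ₜ (ext ρ c)) c ≡⟨ cong₂ diagCodeWith (wk-sound u ρ c) c≡numcodeU ⟩
      diagCode U                           ∎
      where
      open ≡-Reasoning
      c≡numcodeU : c ≡ numcode U
      c≡numcodeU = trans (to (Tr-IsNumcode (ext ρ c) (wk u) v₀) c≡numcode) (cong numcode (wk-sound u ρ c))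
    ⟸ : ⟦ m ⟧ₜ ρ ≡ diagCode U → Tr S ρ (IsDiagCode u m)
    ⟸ m≡diag = c , from (Tr-IsNumcode (ext ρ c) (wk u) v₀) (cong numcode (sym (wk-sound u ρ c))) ,
      from (Tr-IsCode (ext ρ c) [] (diagTree (wk u) v₀) (wk m))
        (trans (wk-sound m ρ c) (trans m≡diag (trans (cong (λ v → diagCodeWith v c) (sym (wk-sound u ρ c)))
          (sym (⟦diagTree⟧ (ext ρ c) (wk u) v₀)))))
      where
      c = numcode U

  Tr-Diag : (ρ : Env 0) (B : Fml 1) → Tr S ρ (Diag B) ⇔ Tr S (ext ρ ⌜ B ⌝) B
  Tr-Diag ρ B = mk⇔ ⟹ ⟸
    where
    ⟹ : Tr S ρ (Diag B) → Tr S (ext ρ ⌜ B ⌝) B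
    ⟹ h with h ⌜ B ⌝
    ... | inj₁ ≢⌜B⌝ = contradiction (sym (num-sound ⌜ B ⌝ (ext ρ ⌜ B ⌝))) ≢⌜B⌝
    ... | inj₂ t    = t
    ⟸ : Tr S (ext ρ ⌜ B ⌝) B → Tr S ρ (Diag B)
    ⟸ t m with m ≟ ⌜ B ⌝
    ... | yes refl = inj₂ t
    ... | no  m≢⌜B⌝ = inj₁ λ e → m≢⌜B⌝ (trans e (num-sound ⌜ B ⌝ (ext ρ m)))

  Fa-Diag : (ρ : Env 0) (B : Fml 1) → Fa S ρ (Diag B) ⇔ Fa S (ext ρ ⌜ B ⌝) B
  Fa-Diag ρ B = mk⇔ ⟹ (λ f → ⌜ B ⌝ , sym (num-sound ⌜ B ⌝ (ext ρ ⌜ B ⌝)) , f)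
    where
    ⟹ : Fa S ρ (Diag B) → Fa S (ext ρ ⌜ B ⌝) B
    ⟹ (m , e , f) with refl ← trans e (num-sound ⌜ B ⌝ (ext ρ m)) = f

-- Opaque: the code of TrueOfDiag is astronomically large and must never be normalised.
opaque
  TrueOfDiag : Fml 1
  TrueOfDiag = `∃ (IsDiagCode v₁ v₀ `∧ `True v₀)

module _ {S : Pred ℕ 0ℓ} (ρ : Env 0) (u : ℕ) where
  opaque
    unfolding TrueOfDiag

    Tr-TrueOfDiag : Tr S (ext ρ u) TrueOfDiag ⇔ S (diagCode u)
    Tr-TrueOfDiag = mk⇔ ⟹ ⟸
      where
      ⟹ : Tr S (ext ρ u) TrueOfDiag → S (diagCode u)
      ⟹ (m , m≡diag , s) = subst S (to (Tr-IsDiagCode {S = S} (ext (ext ρ u) m) v₁ v₀) m≡diag) s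
      ⟸ : S (diagCode u) → Tr S (ext ρ u) TrueOfDiag
      ⟸ s = diagCode u , from (Tr-IsDiagCode {S = S} (ext (ext ρ u) (diagCode u)) v₁ v₀) refl , s

    Fa-TrueOfDiag⇒FalseCode : Fa S (ext ρ u) TrueOfDiag → FalseCode S (diagCode u)
    Fa-TrueOfDiag⇒FalseCode f with f (diagCode u)
    ... | inj₂ isFalse  = isFalse
    ... | inj₁ not-diag = ⊥-elim (arithmetical-disjoint {S = S} (ext (ext ρ u) (diagCode u)) (IsDiagCode v₁ v₀) _
            (from (Tr-IsDiagCode {S = S} (ext (ext ρ u) (diagCode u)) v₁ v₀) refl) not-diag)

    FalseCode⇒Fa-TrueOfDiag : ExcludedMiddle (lsuc 0ℓ) → FalseCode S (diagCode u) → Fa S (ext ρ u) TrueOfDiag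
    FalseCode⇒Fa-TrueOfDiag em isFalse m with m ≟ diagCode u
    ... | yes refl = inj₂ isFalse
    ... | no  m≢diag with arithmetical-bivalent {S = S} em (ext (ext ρ u) m) (IsDiagCode v₁ v₀) _
    ...   | inj₁ diag     = contradiction (to (Tr-IsDiagCode {S = S} (ext (ext ρ u) m) v₁ v₀) diag) m≢diag
    ...   | inj₂ not-diag = inj₁ not-diag

-- By Tr-Diag and Tr-TrueOfDiag, truthTeller says True ⌜ truthTeller ⌝ and liar says ¬ True ⌜ liar ⌝.
truthTeller liar : Sentence
truthTeller = Diag TrueOfDiag
liar        = Diag (`¬ TrueOfDiag)

module _ {S : Pred ℕ 0ℓ} where

  truthTeller-true : S ⌜ truthTeller ⌝ → TrueIn S truthTeller
  truthTeller-true s = from (Tr-Diag _ TrueOfDiag)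
    (from (Tr-TrueOfDiag _ ⌜ TrueOfDiag ⌝) (subst S (⌜Diag⌝ TrueOfDiag) s))

  truthTeller-false : ExcludedMiddle (lsuc 0ℓ) → FalseCode S ⌜ truthTeller ⌝ → FalseIn S truthTeller
  truthTeller-false em f = from (Fa-Diag _ TrueOfDiag)
    (FalseCode⇒Fa-TrueOfDiag _ ⌜ TrueOfDiag ⌝ em (subst (FalseCode S) (⌜Diag⌝ TrueOfDiag) f))

  liar-true : TrueIn S liar → FalseCode S ⌜ liar ⌝
  liar-true t = subst (FalseCode S) (sym (⌜Diag⌝ (`¬ TrueOfDiag)))
    (Fa-TrueOfDiag⇒FalseCode _ ⌜ `¬ TrueOfDiag ⌝ (to (Tr-Diag _ (`¬ TrueOfDiag)) t))

  liar-false : FalseIn S liar → S ⌜ liar ⌝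
  liar-false f = subst S (sym (⌜Diag⌝ (`¬ TrueOfDiag)))
    (to (Tr-TrueOfDiag _ ⌜ `¬ TrueOfDiag ⌝) (to (Fa-Diag _ (`¬ TrueOfDiag)) f))

module _ (w : FIX) where
  private
    W = proj₁ w

  liar-not-true : ¬ TrueIn W liar
  liar-not-true t = fix-disjoint w _ liar t (to (fix-falseCode⇔false w liar) (liar-true t))

  liar-not-false : ¬ FalseIn W liar
  liar-not-false f = fix-disjoint w _ liar (to (fix-member⇔true w liar) (liar-false f)) f

singleton-sound : (φ : Sentence) → TrueIn ｛ ⌜ φ ⌝ ｝ φ → Sound ｛ ⌜ φ ⌝ ｝
singleton-sound φ t = record
  { onlyTrueCodes = λ { _ refl → φ , refl , t }
  ; consistent    = λ ψ (φ≡ψ , φ≡¬ψ) →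
      ¬-irreflexive ψ (trans (sym (⌜⌝-injective φ (`¬ ψ) φ≡¬ψ)) (⌜⌝-injective φ ψ φ≡ψ))
  }

module _ (em : ExcludedMiddle (lsuc 0ℓ)) where

  truthTeller-true-somewhere : Σ FIX λ w → TrueIn (proj₁ w) truthTeller
  truthTeller-true-somewhere = w , member⇒true (IsFixedPoint.onlyTrueCodes (proj₂ w)) truthTeller (seed refl)
    where
    w = closure-fix (singleton-sound truthTeller (truthTeller-true refl))

  truthTeller-false-somewhere : Σ FIX λ w → FalseIn (proj₁ w) truthTeller
  truthTeller-false-somewhere = w , member⇒true (IsFixedPoint.onlyTrueCodes (proj₂ w)) (`¬ truthTeller) (seed refl)
    where
    w = closure-fix (singleton-sound (`¬ truthTeller) (truthTeller-false em (inj₂ (truthTeller , refl , refl))))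

  truthTeller-lfp-neither : ¬ TrueIn (proj₁ lfp) truthTeller × ¬ FalseIn (proj₁ lfp) truthTeller
  truthTeller-lfp-neither =
    (λ t → let w , f = truthTeller-false-somewhere in fix-disjoint w _ truthTeller (lfp-true w truthTeller t) f) ,
    (λ f → let w , t = truthTeller-true-somewhere in fix-disjoint w _ truthTeller t (lfp-false w truthTeller f))

data Value : Set where
  vt vf vn : Value

record ValueSet : Set where
  constructor ⟨_,_,_⟩
  field
    hasT hasF hasN : Bool

infix 5 _∋_
_∋_ : ValueSet → Value → Bool
V ∋ vt = ValueSet.hasT V
V ∋ vf = ValueSet.hasF V
V ∋ vn = ValueSet.hasN V

infixr 4 _⇒ᵇ_
_⇒ᵇ_ : Bool → Bool → Bool
true  ⇒ᵇ b = b
false ⇒ᵇ _ = true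

every : ValueSet → (Value → Bool) → Bool
every V g = (V ∋ vt ⇒ᵇ g vt) ∧ (V ∋ vf ⇒ᵇ g vf) ∧ (V ∋ vn ⇒ᵇ g vn)

isT isF : Value → Bool
isT vt = true
isT _  = false
isF vf = true
isF _  = false

-- The truth of A in a fixed point where x⋆ has value c, when x⋆ takes exactly the values in V.
ev : MF → Value → ValueSet → Bool
ev (T _)    c V = isT c
ev (F _)    c V = isF c
ev (~ A)    c V = not (ev A c V)
ev (A ∧□ B) c V = ev A c V ∧ ev B c V
ev (□ A)    c V = every V (λ c′ → ev A c′ V)

grounded : ValueSet → Bool
grounded ⟨ true , true , false ⟩ = false
grounded _                        = true

-- The pairs that occur: c ∈ V, and V ≠ {true, false} by Ground.
admissible : Value → ValueSet → Bool
admissible c V = grounded V ∧ (V ∋ c)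

So-⇒ᵇ : ∀ a {b} → So (a ⇒ᵇ b) ⇔ (So a → So b)
So-⇒ᵇ true  = mk⇔ (λ b _ → b) (λ f → f _)
So-⇒ᵇ false = mk⇔ (λ _ ()) _

So-every : ∀ V g → So (every V g) ⇔ (∀ c → So (V ∋ c) → So (g c))
So-every V g = mk⇔ ⟹ ⟸
  where
  split : So (every V g) → So (V ∋ vt ⇒ᵇ g vt) × So (V ∋ vf ⇒ᵇ g vf) × So (V ∋ vn ⇒ᵇ g vn)
  split all = let t , rest = to (T-∧ {V ∋ vt ⇒ᵇ g vt}) all in t , to (T-∧ {V ∋ vf ⇒ᵇ g vf}) rest
  ⟹ : So (every V g) → ∀ c → So (V ∋ c) → So (g c)
  ⟹ all vt = to (So-⇒ᵇ (V ∋ vt)) (proj₁ (split all))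
  ⟹ all vf = to (So-⇒ᵇ (V ∋ vf)) (proj₁ (proj₂ (split all)))
  ⟹ all vn = to (So-⇒ᵇ (V ∋ vn)) (proj₂ (proj₂ (split all)))
  ⟸ : (∀ c → So (V ∋ c) → So (g c)) → So (every V g)
  ⟸ h = from (T-∧ {V ∋ vt ⇒ᵇ g vt}) (from (So-⇒ᵇ (V ∋ vt)) (h vt) ,
          from (T-∧ {V ∋ vf ⇒ᵇ g vf}) (from (So-⇒ᵇ (V ∋ vf)) (h vf) , from (So-⇒ᵇ (V ∋ vn)) (h vn)))

implies-or-counterexample : ∀ a b → (So a → So b) ⊎ (So a × ¬ So b)
implies-or-counterexample false _     = inj₁ λ ()
implies-or-counterexample true  true  = inj₁ _
implies-or-counterexample true  false = inj₂ (_ , λ ())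

every-counterexample : ∀ V g → ¬ So (every V g) → Σ Value λ c → So (V ∋ c) × ¬ So (g c)
every-counterexample V g not-every
  with implies-or-counterexample (V ∋ vt) (g vt)
     | implies-or-counterexample (V ∋ vf) (g vf)
     | implies-or-counterexample (V ∋ vn) (g vn)
... | inj₂ bad | _        | _        = vt , bad
... | _        | inj₂ bad | _        = vf , bad
... | _        | _        | inj₂ bad = vn , bad
... | inj₁ t   | inj₁ f   | inj₁ n   = contradiction (from (So-every V g) λ { vt → t ; vf → f ; vn → n }) not-every

HasValue : FIX → Sentence → Value → Set
HasValue (W , _) σ vt = TrueIn W σ
HasValue (W , _) σ vf = FalseIn W σ
HasValue (W , _) σ vn = ¬ TrueIn W σ × ¬ FalseIn W σ

value : ExcludedMiddle (lsuc 0ℓ) → (w : FIX) (σ : Sentence) → Σ Value (HasValue w σ)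
value em (W , _) σ with decide em (TrueIn W σ) | decide em (FalseIn W σ)
... | yes t   | _      = vt , t
... | no  ¬t  | yes f  = vf , f
... | no  ¬t  | no ¬f  = vn , ¬t , ¬f

record Realizes (V : ValueSet) (σ : Sentence) : Set₁ where
  field
    only   : ∀ w c → HasValue w σ c → So (V ∋ c)
    attain : ∀ c → So (V ∋ c) → Σ FIX λ w → HasValue w σ c

module _ (em : ExcludedMiddle (lsuc 0ℓ)) {V : ValueSet} {σ : Sentence} (realizes : Realizes V σ) where
  open Realizes realizes

  ⊩⇔ev : ∀ A w c → HasValue w σ c → (w ⊩[ (λ _ → σ) ] A) ⇔ So (ev A c V)
  ⊩⇔ev (T _)    w vt t        = mk⇔ _ (λ _ → lift t)
  ⊩⇔ev (T _)    w vf f        = mk⇔ (λ (lift t) → fix-disjoint w _ σ t f) λ ()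
  ⊩⇔ev (T _)    w vn (¬t , _) = mk⇔ (λ (lift t) → ¬t t) λ ()
  ⊩⇔ev (F _)    w vt t        = mk⇔ (λ (lift f) → fix-disjoint w _ σ t f) λ ()
  ⊩⇔ev (F _)    w vf f        = mk⇔ _ (λ _ → lift f)
  ⊩⇔ev (F _)    w vn (_ , ¬f) = mk⇔ (λ (lift f) → ¬f f) λ ()
  ⊩⇔ev (~ A)    w c  h        = So-not (⊩⇔ev A w c h)
  ⊩⇔ev (A ∧□ B) w c  h        = ⇔-sym T-∧ ⇔-∘ (⊩⇔ev A w c h ×-⇔ ⊩⇔ev B w c h)
  ⊩⇔ev (□ A)    w c  h        = ⇔-sym (So-every V (λ c′ → ev A c′ V)) ⇔-∘ mk⇔ ⟹ ⟸
    where
    ⟹ : (∀ v → v ⊩[ (λ _ → σ) ] A) → ∀ c′ → So (V ∋ c′) → So (ev A c′ V)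
    ⟹ □A c′ c′∈V = let v , h′ = attain c′ c′∈V in to (⊩⇔ev A v c′ h′) (□A v)
    ⟸ : (∀ c′ → So (V ∋ c′) → So (ev A c′ V)) → ∀ v → v ⊩[ (λ _ → σ) ] A
    ⟸ all v = let c′ , h′ = value em v σ in from (⊩⇔ev A v c′ h′) (all c′ (only v c′ h′))

_`∨_ : Fml n → Fml n → Fml n
φ `∨ ψ = `¬ ((`¬ φ) `∧ (`¬ ψ))

zero≡zero : Sentence
zero≡zero = `zero `≡ `zero

realizes-t : Realizes ⟨ true , false , false ⟩ zero≡zero
realizes-t = record
  { only   = λ { w vt _ → _ ; w vf 0≢0 → 0≢0 refl ; w vn (¬t , _) → ¬t refl }
  ; attain = λ { vt _ → lfp , refl } }

realizes-f : Realizes ⟨ false , true , false ⟩ (`¬ zero≡zero)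
realizes-f = record
  { only   = λ { w vt 0≢0 → 0≢0 refl ; w vf _ → _ ; w vn (_ , ¬f) → ¬f refl }
  ; attain = λ { vf _ → lfp , refl } }

realizes-n : Realizes ⟨ false , false , true ⟩ liar
realizes-n = record
  { only   = λ { w vt t → liar-not-true w t ; w vf f → liar-not-false w f ; w vn _ → _ }
  ; attain = λ { vn _ → lfp , liar-not-true lfp , liar-not-false lfp } }

module _ (em : ExcludedMiddle (lsuc 0ℓ)) where

  realizes-tfn : Realizes ⟨ true , true , true ⟩ truthTeller
  realizes-tfn = record
    { only   = λ { w vt _ → _ ; w vf _ → _ ; w vn _ → _ }
    ; attain = λ { vt _ → truthTeller-true-somewhere em
                 ; vf _ → truthTeller-false-somewhere em
                 ; vn _ → lfp , truthTeller-lfp-neither em } }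

  realizes-tn : Realizes ⟨ true , false , true ⟩ (truthTeller `∨ liar)
  realizes-tn = record
    { only   = λ { w vt _ → _ ; w vf (_ , f) → liar-not-false w f ; w vn _ → _ }
    ; attain = λ { vt _ → let w , t = truthTeller-true-somewhere em in w , inj₁ t
                 ; vn _ → lfp , [ proj₁ (truthTeller-lfp-neither em) , liar-not-true lfp ]′
                              , (λ (_ , f) → liar-not-false lfp f) } }

  realizes-fn : Realizes ⟨ false , true , true ⟩ (truthTeller `∧ liar)
  realizes-fn = record
    { only   = λ { w vt (_ , t) → liar-not-true w t ; w vf _ → _ ; w vn _ → _ }
    ; attain = λ { vf _ → let w , f = truthTeller-false-somewhere em in w , inj₁ f
                 ; vn _ → lfp , (λ (_ , t) → liar-not-true lfp t)
                              , [ proj₂ (truthTeller-lfp-neither em) , liar-not-false lfp ]′ } }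

  realize : ∀ c V → So (admissible c V) → Σ Sentence (Realizes V)
  realize _ ⟨ true  , false , false ⟩ _ = _ , realizes-t
  realize _ ⟨ false , true  , false ⟩ _ = _ , realizes-f
  realize _ ⟨ false , false , true  ⟩ _ = _ , realizes-n
  realize _ ⟨ true  , true  , true  ⟩ _ = _ , realizes-tfn
  realize _ ⟨ true  , false , true  ⟩ _ = _ , realizes-tn
  realize _ ⟨ false , true  , true  ⟩ _ = _ , realizes-fn
  realize vt ⟨ false , false , false ⟩ ()
  realize vf ⟨ false , false , false ⟩ ()
  realize vn ⟨ false , false , false ⟩ ()

  FIX⊩⇒ev : ∀ φ → FIX⊩ φ → ∀ c V → So (admissible c V) → So (ev φ c V)
  FIX⊩⇒ev φ valid c V adm =
    let σ , realizes = realize c V adm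
        w , h        = Realizes.attain realizes c (proj₂ (to (T-∧ {grounded V}) adm))
    in to (⊩⇔ev em realizes φ w c h) (valid (λ _ → σ) w)

width : PF → ℕ
width (p i)    = suc i
width (¬ₚ a)   = width a
width (a ∧ₚ b) = width a ⊔ width b

_∷ᵛ_ : Bool → (ℕ → Bool) → ℕ → Bool
(b ∷ᵛ v) zero    = b
(b ∷ᵛ v) (suc i) = v i

truncate : ℕ → (ℕ → Bool) → ℕ → Bool
truncate zero    v = λ _ → false
truncate (suc k) v = v 0 ∷ᵛ truncate k (λ i → v (suc i))

truncate-agrees : ∀ k v i → i < k → truncate k v i ≡ v i
truncate-agrees (suc k) v zero    _       = refl
truncate-agrees (suc k) v (suc i) (s≤s i<k) = truncate-agrees k (λ j → v (suc j)) i i<k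

allValuations : ℕ → ((ℕ → Bool) → Bool) → Bool
allValuations zero    f = f (λ _ → false)
allValuations (suc k) f = allValuations k (λ v → f (true ∷ᵛ v)) ∧ allValuations k (λ v → f (false ∷ᵛ v))

allValuations-sound : ∀ k f → So (allValuations k f) → ∀ v → So (f (truncate k v))
allValuations-sound zero    f ok v = ok
allValuations-sound (suc k) f ok v with v 0 | to (T-∧ {allValuations k (λ v → f (true ∷ᵛ v))}) ok
... | true  | ok₁ , _ = allValuations-sound k (λ v → f (true ∷ᵛ v)) ok₁ (λ i → v (suc i))
... | false | _ , ok₀ = allValuations-sound k (λ v → f (false ∷ᵛ v)) ok₀ (λ i → v (suc i))

evalP-local : ∀ a {v v′} → (∀ i → i < width a → v i ≡ v′ i) → evalP v a ≡ evalP v′ a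
evalP-local (p i)    agree = agree i ≤-refl
evalP-local (¬ₚ a)   agree = cong not (evalP-local a agree)
evalP-local (a ∧ₚ b) agree = cong₂ _∧_
  (evalP-local a λ i i<w → agree i (≤-trans i<w (m≤m⊔n (width a) (width b))))
  (evalP-local b λ i i<w → agree i (≤-trans i<w (m≤n⊔m (width a) (width b))))

isTautology : PF → Bool
isTautology a = allValuations (width a) (λ v → evalP v a)

isTautology-sound : ∀ a → So (isTautology a) → Tautology a
isTautology-sound a ok v = trans
  (evalP-local a λ i i<w → sym (truncate-agrees (width a) v i i<w))
  (to T-≡ (allValuations-sound (width a) (λ v → evalP v a) ok v))

infixr 4 _⇒ₚ_
_⇒ₚ_ : PF → PF → PF
a ⇒ₚ b = ¬ₚ (a ∧ₚ (¬ₚ b))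

_⟹ₚ_ : List PF → PF → PF
[]       ⟹ₚ c = c
(a ∷ as) ⟹ₚ c = a ⇒ₚ (as ⟹ₚ c)

-- Out-of-range indices get a junk atom; every substitution instance of a tautology is an axiom.
atom : List MF → ℕ → MF
atom []       _       = T 0
atom (A ∷ _)  zero    = A
atom (_ ∷ As) (suc i) = atom As i

propositional : (atoms : List MF) (premises : List PF) (conclusion : PF) →
                {So (isTautology (premises ⟹ₚ conclusion))} →
                All (λ a → ⊢S5CG (substP (atom atoms) a)) premises → ⊢S5CG (substP (atom atoms) conclusion)
propositional atoms premises conclusion {ok} =
  discharge premises (taut (premises ⟹ₚ conclusion) (isTautology-sound (premises ⟹ₚ conclusion) ok) (atom atoms))
  where
  discharge : ∀ as → ⊢S5CG (substP (atom atoms) (as ⟹ₚ conclusion)) →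
              All (λ a → ⊢S5CG (substP (atom atoms) a)) as → ⊢S5CG (substP (atom atoms) conclusion)
  discharge []       d []         = d
  discharge (a ∷ as) d (da ∷ das) = discharge as (mp d da) das

private
  p₀ p₁ p₂ p₃ p₄ p₅ p₆ p₇ : PF
  p₀ = p 0
  p₁ = p 1
  p₂ = p 2
  p₃ = p 3
  p₄ = p 4
  p₅ = p 5
  p₆ = p 6
  p₇ = p 7

infixr 6 _&_
_&_ : PF → PF → PF
_&_ = _∧ₚ_

⇒-trans : ∀ {A B C} → ⊢S5CG (A ⇒ B) → ⊢S5CG (B ⇒ C) → ⊢S5CG (A ⇒ C)
⇒-trans {A} {B} {C} A⇒B B⇒C =
  propositional (A ∷ B ∷ C ∷ []) ((p₀ ⇒ₚ p₁) ∷ (p₁ ⇒ₚ p₂) ∷ []) (p₀ ⇒ₚ p₂) (A⇒B ∷ B⇒C ∷ [])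

double-negation : ∀ A → ⊢S5CG (A ⇒ ~ ~ A)
double-negation A = propositional (A ∷ []) [] (p₀ ⇒ₚ ¬ₚ ¬ₚ p₀) []

□-mono : ∀ {A B} → ⊢S5CG (A ⇒ B) → ⊢S5CG (□ A ⇒ □ B)
□-mono {A} {B} A⇒B = mp (K A B) (nec A⇒B)

◇-mono : ∀ {A B} → ⊢S5CG (A ⇒ B) → ⊢S5CG (◇ A ⇒ ◇ B)
◇-mono {A} {B} A⇒B =
  propositional (□ (~ B) ∷ □ (~ A) ∷ []) ((p₀ ⇒ₚ p₁) ∷ []) (¬ₚ p₁ ⇒ₚ ¬ₚ p₀)
    (□-mono (propositional (A ∷ B ∷ []) ((p₀ ⇒ₚ p₁) ∷ []) (¬ₚ p₁ ⇒ₚ ¬ₚ p₀) (A⇒B ∷ [])) ∷ [])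

□-∧ : ∀ A B → ⊢S5CG (□ A ⇒ (□ B ⇒ □ (A ∧□ B)))
□-∧ A B =
  propositional (□ A ∷ □ (B ⇒ (A ∧□ B)) ∷ □ B ∷ □ (A ∧□ B) ∷ [])
    ((p₀ ⇒ₚ p₁) ∷ (p₁ ⇒ₚ (p₂ ⇒ₚ p₃)) ∷ []) (p₀ ⇒ₚ (p₂ ⇒ₚ p₃))
    (□-mono (propositional (A ∷ B ∷ []) [] (p₀ ⇒ₚ (p₁ ⇒ₚ (p₀ & p₁))) []) ∷ K B (A ∧□ B) ∷ [])

□-mono₃ : ∀ {A B C D} → ⊢S5CG (A ⇒ (B ⇒ (C ⇒ D))) → ⊢S5CG (□ A ⇒ (□ B ⇒ (□ C ⇒ □ D)))
□-mono₃ {A} {B} {C} {D} d =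
  propositional (□ A ∷ □ (B ⇒ (C ⇒ D)) ∷ □ B ∷ □ (C ⇒ D) ∷ □ C ∷ □ D ∷ [])
    ((p₀ ⇒ₚ p₁) ∷ (p₁ ⇒ₚ (p₂ ⇒ₚ p₃)) ∷ (p₃ ⇒ₚ (p₄ ⇒ₚ p₅)) ∷ []) (p₀ ⇒ₚ (p₂ ⇒ₚ (p₄ ⇒ₚ p₅)))
    (□-mono d ∷ K B (C ⇒ D) ∷ K C D ∷ [])

□◇-∧ : ∀ A B → ⊢S5CG (□ A ⇒ (◇ B ⇒ ◇ (B ∧□ A)))
□◇-∧ A B =
  propositional (□ A ∷ □ (~ (B ∧□ A) ⇒ ~ B) ∷ □ (~ (B ∧□ A)) ∷ □ (~ B) ∷ [])
    ((p₀ ⇒ₚ p₁) ∷ (p₁ ⇒ₚ (p₂ ⇒ₚ p₃)) ∷ []) (p₀ ⇒ₚ (¬ₚ p₃ ⇒ₚ ¬ₚ p₂))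
    (□-mono (propositional (A ∷ B ∷ []) [] (p₀ ⇒ₚ (¬ₚ (p₁ & p₀) ⇒ₚ ¬ₚ p₁)) []) ∷ K (~ (B ∧□ A)) (~ B) ∷ [])

-- For Z = □ ~~B, T and 5 give Z → ◇ Z → □ ◇ Z, and ◇ Z → Z is the contrapositive of 5 for ~ B.
axiom-4 : ∀ B → ⊢S5CG (□ B ⇒ □ (□ B))
axiom-4 B = ⇒-trans (□-mono (double-negation B)) (⇒-trans Z⇒□◇Z (□-mono (⇒-trans ◇Z⇒Z (□-mono ¬¬B⇒B))))
  where
  Z = □ (~ (~ B))
  ¬¬B⇒B = propositional (B ∷ []) [] (¬ₚ ¬ₚ p₀ ⇒ₚ p₀) []
  Z⇒□◇Z : ⊢S5CG (Z ⇒ □ (◇ Z))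
  Z⇒□◇Z = ⇒-trans (propositional (Z ∷ □ (~ Z) ∷ []) ((p₁ ⇒ₚ ¬ₚ p₀) ∷ []) (p₀ ⇒ₚ ¬ₚ p₁) (Tax (~ Z) ∷ [])) (5ax Z)
  ◇Z⇒Z : ⊢S5CG (◇ Z ⇒ Z)
  ◇Z⇒Z = propositional (Z ∷ □ (~ Z) ∷ []) ((¬ₚ p₀ ⇒ₚ p₁) ∷ []) (¬ₚ p₁ ⇒ₚ p₀) (5ax (~ B) ∷ [])

literal : Bool → MF → MF
literal true  A = A
literal false A = ~ A

decide-literal : ∀ {X A} b → (So b → ⊢S5CG (X ⇒ A)) → (¬ So b → ⊢S5CG (X ⇒ ~ A)) → ⊢S5CG (X ⇒ literal b A)
decide-literal true  positive _        = positive _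
decide-literal false _        negative = negative λ ()

literal-true : ∀ {X A} b → So b → ⊢S5CG (X ⇒ literal b A) → ⊢S5CG (X ⇒ A)
literal-true true _ d = d

literal-false : ∀ {X A} b → ¬ So b → ⊢S5CG (X ⇒ literal b A) → ⊢S5CG (X ⇒ ~ A)
literal-false false _  d = d
literal-false true  ¬b _ = contradiction _ ¬b

literal-~ : ∀ {X A} b → ⊢S5CG (X ⇒ literal b A) → ⊢S5CG (X ⇒ literal (not b) (~ A))
literal-~ true  d = ⇒-trans d (double-negation _)
literal-~ false d = d

literal-∧ : ∀ {X A B} a b → ⊢S5CG (X ⇒ literal a A) → ⊢S5CG (X ⇒ literal b B) →
            ⊢S5CG (X ⇒ literal (a ∧ b) (A ∧□ B))
literal-∧ {X} {A} {B} true true dA dB =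
  propositional (X ∷ A ∷ B ∷ []) ((p₀ ⇒ₚ p₁) ∷ (p₀ ⇒ₚ p₂) ∷ []) (p₀ ⇒ₚ p₁ & p₂) (dA ∷ dB ∷ [])
literal-∧ {X} {A} {B} true false dA dB =
  propositional (X ∷ A ∷ B ∷ []) ((p₀ ⇒ₚ ¬ₚ p₂) ∷ []) (p₀ ⇒ₚ ¬ₚ (p₁ & p₂)) (dB ∷ [])
literal-∧ {X} {A} {B} false _ dA dB =
  propositional (X ∷ A ∷ B ∷ []) ((p₀ ⇒ₚ ¬ₚ p₁) ∷ []) (p₀ ⇒ₚ ¬ₚ (p₁ & p₂)) (dA ∷ [])

module Completeness (x : ℕ) where

  Lit : Value → MF
  Lit vt = T x
  Lit vf = F x
  Lit vn = N x

  possibility : Bool → Value → MF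
  possibility true  c = ◇ Lit c
  possibility false c = □ (~ Lit c)

  Profile : ValueSet → MF
  Profile V = possibility (V ∋ vt) vt ∧□ (possibility (V ∋ vf) vf ∧□ possibility (V ∋ vn) vn)

  possibilities : ValueSet → List MF
  possibilities V = possibility (V ∋ vt) vt ∷ possibility (V ∋ vf) vf ∷ possibility (V ∋ vn) vn ∷ []

  χ : Value → ValueSet → MF
  χ c V = Lit c ∧□ Profile V

  Profile-possibility : ∀ V c → ⊢S5CG (Profile V ⇒ possibility (V ∋ c) c)
  Profile-possibility V vt = propositional (possibilities V) [] (p₀ & p₁ & p₂ ⇒ₚ p₀) []
  Profile-possibility V vf = propositional (possibilities V) [] (p₀ & p₁ & p₂ ⇒ₚ p₁) []
  Profile-possibility V vn = propositional (possibilities V) [] (p₀ & p₁ & p₂ ⇒ₚ p₂) []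

  Profile-◇ : ∀ V c → So (V ∋ c) → ⊢S5CG (Profile V ⇒ ◇ Lit c)
  Profile-◇ V c c∈V with V ∋ c | Profile-possibility V c
  ... | true  | d = d
  ... | false | _ = ⊥-elim c∈V

  Profile-□¬ : ∀ V c → ¬ So (V ∋ c) → ⊢S5CG (Profile V ⇒ □ (~ Lit c))
  Profile-□¬ V c c∉V with V ∋ c | Profile-possibility V c
  ... | false | d = d
  ... | true  | _ = contradiction _ c∉V

  possibility-□ : ∀ b c → ⊢S5CG (possibility b c ⇒ □ possibility b c)
  possibility-□ true  c = 5ax (Lit c)
  possibility-□ false c = axiom-4 (~ Lit c)

  Profile-□ : ∀ V → ⊢S5CG (Profile V ⇒ □ Profile V)
  Profile-□ V =
    propositional (P₁ ∷ P₂ ∷ P₃ ∷ □ P₁ ∷ □ P₂ ∷ □ P₃ ∷ □ (P₂ ∧□ P₃) ∷ □ (P₁ ∧□ (P₂ ∧□ P₃)) ∷ [])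
      ((p₀ ⇒ₚ p₃) ∷ (p₁ ⇒ₚ p₄) ∷ (p₂ ⇒ₚ p₅) ∷ (p₄ ⇒ₚ (p₅ ⇒ₚ p₆)) ∷ (p₃ ⇒ₚ (p₆ ⇒ₚ p₇)) ∷ [])
      (p₀ & p₁ & p₂ ⇒ₚ p₇)
      (possibility-□ _ vt ∷ possibility-□ _ vf ∷ possibility-□ _ vn ∷ □-∧ P₂ P₃ ∷ □-∧ P₁ (P₂ ∧□ P₃) ∷ [])
    where
    P₁ = possibility (V ∋ vt) vt
    P₂ = possibility (V ∋ vf) vf
    P₃ = possibility (V ∋ vn) vn

  χ-decides : ∀ φ → OnlyVar x φ → ∀ c V → ⊢S5CG (χ c V ⇒ literal (ev φ c V) φ)
  χ-decides (T _) refl vt V = propositional (T x ∷ Profile V ∷ []) [] (p₀ & p₁ ⇒ₚ p₀) []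
  χ-decides (T _) refl vf V =
    propositional (T x ∷ F x ∷ Profile V ∷ []) (¬ₚ (p₀ & p₁) ∷ []) (p₁ & p₂ ⇒ₚ ¬ₚ p₀) (con x ∷ [])
  χ-decides (T _) refl vn V = propositional (T x ∷ F x ∷ Profile V ∷ []) [] ((¬ₚ p₀ & ¬ₚ p₁) & p₂ ⇒ₚ ¬ₚ p₀) []
  χ-decides (F _) refl vt V =
    propositional (T x ∷ F x ∷ Profile V ∷ []) (¬ₚ (p₀ & p₁) ∷ []) (p₀ & p₂ ⇒ₚ ¬ₚ p₁) (con x ∷ [])
  χ-decides (F _) refl vf V = propositional (F x ∷ Profile V ∷ []) [] (p₀ & p₁ ⇒ₚ p₀) []
  χ-decides (F _) refl vn V = propositional (T x ∷ F x ∷ Profile V ∷ []) [] ((¬ₚ p₀ & ¬ₚ p₁) & p₂ ⇒ₚ ¬ₚ p₁) []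
  χ-decides (~ A)    o          c V = literal-~ (ev A c V) (χ-decides A o c V)
  χ-decides (A ∧□ B) (oA , oB)  c V = literal-∧ (ev A c V) (ev B c V) (χ-decides A oA c V) (χ-decides B oB c V)
  χ-decides (□ A)    o          c V = decide-literal (every V (λ c′ → ev A c′ V)) box-true box-false
    where
    box-true : So (every V (λ c′ → ev A c′ V)) → ⊢S5CG (χ c V ⇒ □ A)
    box-true all =
      propositional (Lit c ∷ Profile V ∷ □ (T x ⇒ A) ∷ □ (F x ⇒ A) ∷ □ (N x ⇒ A) ∷ □ A ∷ [])
        ((p₁ ⇒ₚ p₂) ∷ (p₁ ⇒ₚ p₃) ∷ (p₁ ⇒ₚ p₄) ∷ (p₂ ⇒ₚ (p₃ ⇒ₚ (p₄ ⇒ₚ p₅))) ∷ [])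
        (p₀ & p₁ ⇒ₚ p₅)
        (boxed vt ∷ boxed vf ∷ boxed vn ∷ □-mono₃ by-cases ∷ [])
      where
      by-cases = propositional (T x ∷ F x ∷ A ∷ []) []
        ((p₀ ⇒ₚ p₂) ⇒ₚ ((p₁ ⇒ₚ p₂) ⇒ₚ ((¬ₚ p₀ & ¬ₚ p₁ ⇒ₚ p₂) ⇒ₚ p₂))) []
      boxed : ∀ c′ → ⊢S5CG (Profile V ⇒ □ (Lit c′ ⇒ A))
      boxed c′ with T? (V ∋ c′)
      ... | yes c′∈V = ⇒-trans (Profile-□ V) (□-mono (propositional (Lit c′ ∷ Profile V ∷ A ∷ [])
              ((p₀ & p₁ ⇒ₚ p₂) ∷ []) (p₁ ⇒ₚ (p₀ ⇒ₚ p₂))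
              (literal-true (ev A c′ V) (to (So-every V (λ c″ → ev A c″ V)) all c′ c′∈V)
                 (χ-decides A o c′ V) ∷ [])))
      ... | no  c′∉V = ⇒-trans (Profile-□¬ V c′ c′∉V)
              (□-mono (propositional (Lit c′ ∷ A ∷ []) [] (¬ₚ p₀ ⇒ₚ (p₀ ⇒ₚ p₁)) []))
    box-false : ¬ So (every V (λ c′ → ev A c′ V)) → ⊢S5CG (χ c V ⇒ ~ □ A)
    box-false not-all =
      propositional (Lit c ∷ Profile V ∷ □ (Profile V) ∷ ◇ Lit c′ ∷ ◇ (Lit c′ ∧□ Profile V) ∷ ◇ (~ A) ∷ □ A ∷ [])
        ((p₁ ⇒ₚ p₃) ∷ (p₁ ⇒ₚ p₂) ∷ (p₂ ⇒ₚ (p₃ ⇒ₚ p₄)) ∷ (p₄ ⇒ₚ p₅) ∷ (p₅ ⇒ₚ ¬ₚ p₆) ∷ [])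
        (p₀ & p₁ ⇒ₚ ¬ₚ p₆)
        (Profile-◇ V c′ c′∈V ∷ Profile-□ V ∷ □◇-∧ (Profile V) (Lit c′) ∷
         ◇-mono (literal-false (ev A c′ V) ¬A (χ-decides A o c′ V)) ∷ ◇¬A⇒¬□A ∷ [])
      where
      counterexample = every-counterexample V (λ c′ → ev A c′ V) not-all
      c′ = proj₁ counterexample
      c′∈V = proj₁ (proj₂ counterexample)
      ¬A = proj₂ (proj₂ counterexample)
      ◇¬A⇒¬□A = propositional (□ A ∷ □ (~ ~ A) ∷ []) ((p₀ ⇒ₚ p₁) ∷ []) (¬ₚ p₁ ⇒ₚ ¬ₚ p₀)
                  (□-mono (double-negation A) ∷ [])

  -- With Con, T and Ground, the characteristic formulas of the ten admissible pairs exhaust all cases.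
  complete : ∀ φ → OnlyVar x φ → (∀ c V → So (admissible c V) → So (ev φ c V)) → ⊢S5CG φ
  complete φ o valid =
    propositional (T x ∷ F x ∷ □ (~ T x) ∷ □ (~ F x) ∷ □ (~ N x) ∷ φ ∷ [])
      ( case vt ⟨ true , false , false ⟩
      ∷ case vf ⟨ false , true , false ⟩
      ∷ case vn ⟨ false , false , true ⟩
      ∷ case vt ⟨ true , false , true ⟩
      ∷ case vn ⟨ true , false , true ⟩
      ∷ case vf ⟨ false , true , true ⟩
      ∷ case vn ⟨ false , true , true ⟩
      ∷ case vt ⟨ true , true , true ⟩
      ∷ case vf ⟨ true , true , true ⟩
      ∷ case vn ⟨ true , true , true ⟩
      ∷ ¬ₚ (p₀ & p₁) ∷ (p₂ ⇒ₚ ¬ₚ p₀) ∷ (p₃ ⇒ₚ ¬ₚ p₁) ∷ (p₄ ⇒ₚ ¬ₚ (¬ₚ p₀ & ¬ₚ p₁)) ∷ (¬ₚ p₂ & ¬ₚ p₃ ⇒ₚ ¬ₚ p₄)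
      ∷ [])
      p₅
      ( point vt ⟨ true , false , false ⟩ _
      ∷ point vf ⟨ false , true , false ⟩ _
      ∷ point vn ⟨ false , false , true ⟩ _
      ∷ point vt ⟨ true , false , true ⟩ _
      ∷ point vn ⟨ true , false , true ⟩ _
      ∷ point vf ⟨ false , true , true ⟩ _
      ∷ point vn ⟨ false , true , true ⟩ _
      ∷ point vt ⟨ true , true , true ⟩ _
      ∷ point vf ⟨ true , true , true ⟩ _
      ∷ point vn ⟨ true , true , true ⟩ _
      ∷ con x ∷ Tax (~ T x) ∷ Tax (~ F x) ∷ Tax (~ N x) ∷ ground x
      ∷ [])
    where
    Litₚ : Value → PF
    Litₚ vt = p₀
    Litₚ vf = p₁
    Litₚ vn = ¬ₚ p₀ & ¬ₚ p₁
    impossibleₚ : Value → PF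
    impossibleₚ vt = p₂
    impossibleₚ vf = p₃
    impossibleₚ vn = p₄
    possibilityₚ : Bool → Value → PF
    possibilityₚ true  c = ¬ₚ impossibleₚ c
    possibilityₚ false c = impossibleₚ c
    case : Value → ValueSet → PF
    case c V = Litₚ c & possibilityₚ (V ∋ vt) vt & possibilityₚ (V ∋ vf) vf & possibilityₚ (V ∋ vn) vn ⇒ₚ p₅
    point : ∀ c V → So (admissible c V) → ⊢S5CG (χ c V ⇒ φ)
    point c V adm = literal-true (ev φ c V) (valid c V adm) (χ-decides φ o c V)

mainTheorem8 : ExcludedMiddle (lsuc 0ℓ) →
    ∀ (x : ℕ) (φ : MF) → OnlyVar x φ → (FIX⊩ φ ⇔ ⊢S5CG φ)
mainTheorem8 em x φ o = mk⇔ (λ valid → complete φ o (FIX⊩⇒ev em φ valid)) (soundness em)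
  where open Completeness x
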